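{- Let $(m,n)\in\{(4,6),(4,12),(6,12)\}$. For nonnegative integers $r$ and $s$, $\mathrm{HWP}^{*}(12; m^{r}, n^{s})$ has a solution if and only if $r+s=11$.
   Context: $K_v^*$ denotes the complete symmetric digraph of order $v$ (both arcs $(x,y)$ and $(y,x)$ for all distinct vertices $x,y$). A directed $C_k$-factor of a digraph is a spanning subdigraph that is a vertex-disjoint union of directed $k$-cycles. $\mathrm{HWP}^{*}(v; m^{r}, n^{s})$ has a solution if the arc set of $K_v^*$ can be partitioned into $r$ directed $C_m$-factors and $s$ directed $C_n$-factors. -}

module Defs where

open import Data.Nat using (ℕ; zero; suc; _<_)
open import Data.Fin using (Fin)
open import Data.Sum using (_⊎_; inj₁; inj₂)
open import Data.Product using (∃; _×_)
open import Relation.Binary.PropositionalEquality using (_≡_; _≢_)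
open import Function.Definitions using (Injective)

iter : {A : Set} → (A → A) → ℕ → A → A
iter f zero    x = x
iter f (suc j) x = f (iter f j x)

-- A directed C_k-factor of K_v^* on vertex set Fin v, represented by its
-- successor map: the arcs of the factor are exactly (x , succ x).
record DirCycleFactor (v k : ℕ) : Set where
  field
    succ       : Fin v → Fin v
    succ-inj   : Injective _≡_ _≡_ succ
    cycle-len  : ∀ x → iter succ k x ≡ x
    cycle-prim : ∀ x j → 0 < j → j < k → iter succ j x ≢ x

open DirCycleFactor public

HasArc : ∀ {v m r n s} → (Fin r → DirCycleFactor v m) → (Fin s → DirCycleFactor v n)
       → Fin r ⊎ Fin s → Fin v → Fin v → Set
HasArc mF nF (inj₁ i) x y = succ (mF i) x ≡ y
HasArc mF nF (inj₂ i) x y = succ (nF i) x ≡ y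

record HWP* (v m r n s : ℕ) : Set where
  field
    mFac      : Fin r → DirCycleFactor v m
    nFac      : Fin s → DirCycleFactor v n
    arcs-in-K : ∀ i x y → HasArc mFac nFac i x y → x ≢ y
    covered   : ∀ x y → x ≢ y → ∃ λ i → HasArc mFac nFac i x y
    disjoint  : ∀ i j x y → HasArc mFac nFac i x y → HasArc mFac nFac j x y → i ≡ j

-- At a vertex x, every factor is a permutation without fixed points, so it contributes exactly
-- one out-arc of x, and since the factors partition the arcs of K_v^*, this is a bijection
-- between the r + s factors and the v - 1 out-neighbours of x; hence r + s = 11.
-- Conversely, for each of the 36 admissible (m, n, r, s) an explicit factorization is given by
-- successor tables and verified by a decision procedure.

module Submission where

open import Defs
open import Data.Nat using (ℕ; suc; _+_; _<_; _<?_)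
open import Data.Fin using (Fin; zero; toℕ; fromℕ<; punchOut; punchIn; #_)
open import Data.Fin.Properties
  using (_≟_; all?; any?; toℕ-fromℕ<; +↔⊎; punchOut-cong′; punchOut-punchIn; punchIn-punchOut; punchInᵢ≢i)
open import Data.Fin.Permutation using (↔⇒≡)
open import Data.Vec using (Vec; []; _∷_; lookup)
open import Data.Product using (_×_; _,_; ∃; proj₁; uncurry)
open import Data.Sum using (_⊎_; inj₁; inj₂; [_,_]; [_,_]′)
import Data.Sum.Properties as ⊎
open import Relation.Nullary using (Dec; ¬?)
open import Relation.Nullary.Decidable using (_×-dec_; _⊎-dec_; _→-dec_; map′; True; toWitness)
open import Relation.Binary.PropositionalEquality using (_≡_; _≢_; refl; sym; trans; subst)
open import Function using (_∘_)
open import Function.Bundles using (_↔_; _⇔_; mk⇔; mk↔ₛ′)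
open import Function.Properties.Inverse using (↔-trans)

module _ {v m r n s : ℕ} (mF : Fin r → DirCycleFactor v m) (nF : Fin s → DirCycleFactor v n) where

  arc : Fin r ⊎ Fin s → Fin v → Fin v
  arc = [ succ ∘ mF , succ ∘ nF ]′

  hasArc-arc : ∀ i x → HasArc mF nF i x (arc i x)
  hasArc-arc (inj₁ i) x = refl
  hasArc-arc (inj₂ i) x = refl

  hasArc⇒arc≡ : ∀ i {x y} → HasArc mF nF i x y → arc i x ≡ y
  hasArc⇒arc≡ (inj₁ i) h = h
  hasArc⇒arc≡ (inj₂ i) h = h

module _ {v m r n s : ℕ} (H : HWP* (suc v) m r n s) where
  open HWP* H

  x≢arc : ∀ i x → x ≢ arc mFac nFac i x
  x≢arc i x = arcs-in-K i x _ (hasArc-arc mFac nFac i x)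

  factors↔outNeighbours : Fin (suc v) → (Fin r ⊎ Fin s) ↔ Fin v
  factors↔outNeighbours x = mk↔ₛ′ outNeighbour factorOf outNeighbour-factorOf factorOf-outNeighbour
    where
    outNeighbour : Fin r ⊎ Fin s → Fin v
    outNeighbour i = punchOut (x≢arc i x)

    factorOf : Fin v → Fin r ⊎ Fin s
    factorOf y = proj₁ (covered x (punchIn x y) (punchInᵢ≢i x y ∘ sym))

    outNeighbour-factorOf : ∀ y → outNeighbour (factorOf y) ≡ y
    outNeighbour-factorOf y with covered x (punchIn x y) (punchInᵢ≢i x y ∘ sym)
    ... | i , h = trans (punchOut-cong′ x (hasArc⇒arc≡ mFac nFac i h)) (punchOut-punchIn x)

    factorOf-outNeighbour : ∀ i → factorOf (outNeighbour i) ≡ i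
    factorOf-outNeighbour i with covered x (punchIn x (outNeighbour i)) (punchInᵢ≢i x _ ∘ sym)
    ... | j , h = disjoint j i x _ (subst (HasArc mFac nFac j x) (punchIn-punchOut (x≢arc i x)) h)
                                   (hasArc-arc mFac nFac i x)

  HWP*⇒r+s≡v : r + s ≡ v
  HWP*⇒r+s≡v = ↔⇒≡ (↔-trans +↔⊎ (factors↔outNeighbours zero))

module _ {a b p} {A : Set a} {B : Set b} {P : A ⊎ B → Set p} where

  ∀⊎? : Dec (∀ x → P (inj₁ x)) → Dec (∀ y → P (inj₂ y)) → Dec (∀ z → P z)
  ∀⊎? p? q? = map′ (uncurry [_,_]) (λ h → h ∘ inj₁ , h ∘ inj₂) (p? ×-dec q?)

  ∃⊎? : Dec (∃ λ x → P (inj₁ x)) → Dec (∃ λ y → P (inj₂ y)) → Dec (∃ P)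
  ∃⊎? p? q? = map′ [ (λ (x , px) → inj₁ x , px) , (λ (y , py) → inj₂ y , py) ]′
                   (λ { (inj₁ x , px) → inj₁ (x , px) ; (inj₂ y , py) → inj₂ (y , py) })
                   (p? ⊎-dec q?)

module _ {v : ℕ} where

  IsCycleFactor : ℕ → (Fin v → Fin v) → Set
  IsCycleFactor k t = (∀ x y → t x ≡ t y → x ≡ y)
                    × (∀ x → iter t k x ≡ x)
                    × (∀ x (j : Fin k) → 0 < toℕ j → iter t (toℕ j) x ≢ x)

  isCycleFactor? : ∀ k t → Dec (IsCycleFactor k t)
  isCycleFactor? k t =
    all? (λ x → all? λ y → t x ≟ t y →-dec x ≟ y) ×-dec
    all? (λ x → iter t k x ≟ x) ×-dec
    all? (λ x → all? λ j → 0 <? toℕ j →-dec ¬? (iter t (toℕ j) x ≟ x))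

  toDirCycleFactor : ∀ {k t} → IsCycleFactor k t → DirCycleFactor v k
  toDirCycleFactor {k} {t} (injective , closes , noShorterCycle) = record
    { succ       = t
    ; succ-inj   = injective _ _
    ; cycle-len  = closes
    ; cycle-prim = λ x j 0<j j<k → subst (λ i → iter t i x ≢ x) (toℕ-fromℕ< j<k)
        (noShorterCycle x (fromℕ< j<k) (subst (0 <_) (sym (toℕ-fromℕ< j<k)) 0<j))
    }

module _ {v r s : ℕ} where

  IsArcPartition : (Fin r ⊎ Fin s → Fin v → Fin v) → Set
  IsArcPartition arc = (∀ i x → arc i x ≢ x)
                     × (∀ x y → x ≢ y → ∃ λ i → arc i x ≡ y)
                     × (∀ i j x → arc i x ≡ arc j x → i ≡ j)

  isArcPartition? : ∀ arc → Dec (IsArcPartition arc)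
  isArcPartition? arc =
    ∀-factor? (λ i → all? λ x → ¬? (arc i x ≟ x)) ×-dec
    all? (λ x → all? λ y → ¬? (x ≟ y) →-dec ∃-factor? λ i → arc i x ≟ y) ×-dec
    ∀-factor? (λ i → ∀-factor? λ j → all? λ x → arc i x ≟ arc j x →-dec ⊎.≡-dec _≟_ _≟_ i j)
    where
    ∀-factor? : {P : Fin r ⊎ Fin s → Set} → (∀ i → Dec (P i)) → Dec (∀ i → P i)
    ∀-factor? P? = ∀⊎? (all? (P? ∘ inj₁)) (all? (P? ∘ inj₂))
    ∃-factor? : {P : Fin r ⊎ Fin s → Set} → (∀ i → Dec (P i)) → Dec (∃ P)
    ∃-factor? P? = ∃⊎? (any? (P? ∘ inj₁)) (any? (P? ∘ inj₂))

  fromSuccessorMaps : ∀ {m n} {M : Fin r → Fin v → Fin v} {N : Fin s → Fin v → Fin v} →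
                      (∀ i → IsCycleFactor m (M i)) → (∀ i → IsCycleFactor n (N i)) →
                      IsArcPartition [ M , N ]′ → HWP* v m r n s
  fromSuccessorMaps {m} {n} mCycles nCycles (loopless , covering , disjointness) = record
    { mFac      = mF
    ; nFac      = nF
    ; arcs-in-K = λ i x y h x≡y → loopless i x (trans (hasArc⇒arc≡ mF nF i h) (sym x≡y))
    ; covered   = λ x y x≢y → let (i , e) = covering x y x≢y
                              in i , subst (HasArc mF nF i x) e (hasArc-arc mF nF i x)
    ; disjoint  = λ i j x y hi hj →
        disjointness i j x (trans (hasArc⇒arc≡ mF nF i hi) (sym (hasArc⇒arc≡ mF nF j hj)))
    }
    where
    mF : Fin r → DirCycleFactor v m
    mF = toDirCycleFactor ∘ mCycles
    nF : Fin s → DirCycleFactor v n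
    nF = toDirCycleFactor ∘ nCycles

SuccessorTable : ℕ → Set
SuccessorTable v = Vec (Fin v) v

IsSolution : ∀ {v r s} → ℕ → ℕ → Vec (SuccessorTable v) r → Vec (SuccessorTable v) s → Set
IsSolution m n M N = (∀ i → IsCycleFactor m (lookup (lookup M i)))
                   × (∀ i → IsCycleFactor n (lookup (lookup N i)))
                   × IsArcPartition [ lookup ∘ lookup M , lookup ∘ lookup N ]′

isSolution? : ∀ {v r s} m n (M : Vec (SuccessorTable v) r) (N : Vec (SuccessorTable v) s) →
              Dec (IsSolution m n M N)
isSolution? m n M N =
  all? (λ _ → isCycleFactor? m _) ×-dec all? (λ _ → isCycleFactor? n _) ×-dec isArcPartition? _

-- The implicit argument reduces to ⊤ exactly when the check succeeds, so it is filled in by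
-- evaluation.
fromTables : ∀ {v m n r s} (M : Vec (SuccessorTable v) r) (N : Vec (SuccessorTable v) s) →
             {True (isSolution? m n M N)} → HWP* v m r n s
fromTables M N {ok} with mCycles , nCycles , partition ← toWitness ok =
  fromSuccessorMaps mCycles nCycles partition

hwp*-12-4-6 : ∀ r s → r + s ≡ 11 → HWP* 12 4 r 6 s
hwp*-12-4-6 0 11 refl = fromTables
  ( [] )
  ( (# 2 ∷ # 0 ∷ # 11 ∷ # 1 ∷ # 8 ∷ # 6 ∷ # 7 ∷ # 10 ∷ # 5 ∷ # 3 ∷ # 4 ∷ # 9 ∷ [])
    ∷ (# 8 ∷ # 3 ∷ # 5 ∷ # 2 ∷ # 9 ∷ # 0 ∷ # 10 ∷ # 4 ∷ # 1 ∷ # 11 ∷ # 7 ∷ # 6 ∷ [])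
    ∷ (# 10 ∷ # 5 ∷ # 4 ∷ # 11 ∷ # 1 ∷ # 3 ∷ # 0 ∷ # 8 ∷ # 6 ∷ # 7 ∷ # 9 ∷ # 2 ∷ [])
    ∷ (# 3 ∷ # 7 ∷ # 10 ∷ # 4 ∷ # 6 ∷ # 9 ∷ # 1 ∷ # 0 ∷ # 2 ∷ # 8 ∷ # 11 ∷ # 5 ∷ [])
    ∷ (# 9 ∷ # 4 ∷ # 0 ∷ # 5 ∷ # 7 ∷ # 2 ∷ # 8 ∷ # 6 ∷ # 11 ∷ # 10 ∷ # 3 ∷ # 1 ∷ [])
    ∷ (# 4 ∷ # 8 ∷ # 9 ∷ # 7 ∷ # 2 ∷ # 11 ∷ # 3 ∷ # 1 ∷ # 10 ∷ # 5 ∷ # 6 ∷ # 0 ∷ [])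
    ∷ (# 5 ∷ # 11 ∷ # 1 ∷ # 0 ∷ # 3 ∷ # 10 ∷ # 2 ∷ # 9 ∷ # 4 ∷ # 6 ∷ # 8 ∷ # 7 ∷ [])
    ∷ (# 7 ∷ # 6 ∷ # 3 ∷ # 8 ∷ # 11 ∷ # 4 ∷ # 5 ∷ # 2 ∷ # 9 ∷ # 0 ∷ # 1 ∷ # 10 ∷ [])
    ∷ (# 1 ∷ # 2 ∷ # 6 ∷ # 10 ∷ # 0 ∷ # 7 ∷ # 9 ∷ # 11 ∷ # 3 ∷ # 4 ∷ # 5 ∷ # 8 ∷ [])
    ∷ (# 6 ∷ # 10 ∷ # 7 ∷ # 9 ∷ # 5 ∷ # 8 ∷ # 11 ∷ # 3 ∷ # 0 ∷ # 1 ∷ # 2 ∷ # 4 ∷ [])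
    ∷ (# 11 ∷ # 9 ∷ # 8 ∷ # 6 ∷ # 10 ∷ # 1 ∷ # 4 ∷ # 5 ∷ # 7 ∷ # 2 ∷ # 0 ∷ # 3 ∷ [])
    ∷ [] )
hwp*-12-4-6 1 10 refl = fromTables
  ( (# 8 ∷ # 11 ∷ # 4 ∷ # 9 ∷ # 0 ∷ # 6 ∷ # 1 ∷ # 10 ∷ # 2 ∷ # 7 ∷ # 3 ∷ # 5 ∷ [])
    ∷ [] )
  ( (# 9 ∷ # 0 ∷ # 3 ∷ # 1 ∷ # 7 ∷ # 11 ∷ # 2 ∷ # 8 ∷ # 5 ∷ # 6 ∷ # 4 ∷ # 10 ∷ [])
    ∷ (# 1 ∷ # 6 ∷ # 5 ∷ # 10 ∷ # 2 ∷ # 3 ∷ # 9 ∷ # 0 ∷ # 4 ∷ # 11 ∷ # 8 ∷ # 7 ∷ [])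
    ∷ (# 10 ∷ # 7 ∷ # 6 ∷ # 4 ∷ # 8 ∷ # 0 ∷ # 3 ∷ # 5 ∷ # 11 ∷ # 1 ∷ # 9 ∷ # 2 ∷ [])
    ∷ (# 11 ∷ # 8 ∷ # 10 ∷ # 5 ∷ # 9 ∷ # 1 ∷ # 7 ∷ # 4 ∷ # 0 ∷ # 2 ∷ # 6 ∷ # 3 ∷ [])
    ∷ (# 2 ∷ # 9 ∷ # 7 ∷ # 11 ∷ # 10 ∷ # 8 ∷ # 4 ∷ # 6 ∷ # 3 ∷ # 5 ∷ # 0 ∷ # 1 ∷ [])
    ∷ (# 3 ∷ # 10 ∷ # 1 ∷ # 6 ∷ # 5 ∷ # 2 ∷ # 8 ∷ # 9 ∷ # 7 ∷ # 0 ∷ # 11 ∷ # 4 ∷ [])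
    ∷ (# 6 ∷ # 2 ∷ # 11 ∷ # 0 ∷ # 1 ∷ # 10 ∷ # 5 ∷ # 3 ∷ # 9 ∷ # 4 ∷ # 7 ∷ # 8 ∷ [])
    ∷ (# 4 ∷ # 5 ∷ # 9 ∷ # 8 ∷ # 3 ∷ # 7 ∷ # 11 ∷ # 2 ∷ # 6 ∷ # 10 ∷ # 1 ∷ # 0 ∷ [])
    ∷ (# 5 ∷ # 3 ∷ # 0 ∷ # 7 ∷ # 6 ∷ # 4 ∷ # 10 ∷ # 11 ∷ # 1 ∷ # 8 ∷ # 2 ∷ # 9 ∷ [])
    ∷ (# 7 ∷ # 4 ∷ # 8 ∷ # 2 ∷ # 11 ∷ # 9 ∷ # 0 ∷ # 1 ∷ # 10 ∷ # 3 ∷ # 5 ∷ # 6 ∷ [])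
    ∷ [] )
hwp*-12-4-6 2 9 refl = fromTables
  ( (# 6 ∷ # 3 ∷ # 8 ∷ # 5 ∷ # 10 ∷ # 11 ∷ # 7 ∷ # 9 ∷ # 4 ∷ # 0 ∷ # 2 ∷ # 1 ∷ [])
    ∷ (# 2 ∷ # 0 ∷ # 5 ∷ # 10 ∷ # 11 ∷ # 1 ∷ # 4 ∷ # 8 ∷ # 3 ∷ # 6 ∷ # 7 ∷ # 9 ∷ [])
    ∷ [] )
  ( (# 9 ∷ # 11 ∷ # 10 ∷ # 0 ∷ # 7 ∷ # 4 ∷ # 2 ∷ # 3 ∷ # 1 ∷ # 5 ∷ # 8 ∷ # 6 ∷ [])
    ∷ (# 11 ∷ # 5 ∷ # 1 ∷ # 8 ∷ # 9 ∷ # 10 ∷ # 3 ∷ # 6 ∷ # 0 ∷ # 2 ∷ # 4 ∷ # 7 ∷ [])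
    ∷ (# 5 ∷ # 2 ∷ # 4 ∷ # 7 ∷ # 3 ∷ # 6 ∷ # 8 ∷ # 10 ∷ # 9 ∷ # 11 ∷ # 1 ∷ # 0 ∷ [])
    ∷ (# 8 ∷ # 6 ∷ # 3 ∷ # 9 ∷ # 2 ∷ # 0 ∷ # 5 ∷ # 1 ∷ # 7 ∷ # 10 ∷ # 11 ∷ # 4 ∷ [])
    ∷ (# 3 ∷ # 8 ∷ # 11 ∷ # 4 ∷ # 5 ∷ # 9 ∷ # 1 ∷ # 0 ∷ # 2 ∷ # 7 ∷ # 6 ∷ # 10 ∷ [])
    ∷ (# 7 ∷ # 4 ∷ # 6 ∷ # 1 ∷ # 8 ∷ # 2 ∷ # 0 ∷ # 11 ∷ # 10 ∷ # 3 ∷ # 9 ∷ # 5 ∷ [])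
    ∷ (# 1 ∷ # 7 ∷ # 9 ∷ # 11 ∷ # 0 ∷ # 3 ∷ # 10 ∷ # 2 ∷ # 6 ∷ # 4 ∷ # 5 ∷ # 8 ∷ [])
    ∷ (# 4 ∷ # 10 ∷ # 7 ∷ # 2 ∷ # 6 ∷ # 8 ∷ # 9 ∷ # 5 ∷ # 11 ∷ # 1 ∷ # 0 ∷ # 3 ∷ [])
    ∷ (# 10 ∷ # 9 ∷ # 0 ∷ # 6 ∷ # 1 ∷ # 7 ∷ # 11 ∷ # 4 ∷ # 5 ∷ # 8 ∷ # 3 ∷ # 2 ∷ [])
    ∷ [] )
hwp*-12-4-6 3 8 refl = fromTables
  ( (# 10 ∷ # 7 ∷ # 1 ∷ # 4 ∷ # 8 ∷ # 0 ∷ # 5 ∷ # 11 ∷ # 9 ∷ # 3 ∷ # 6 ∷ # 2 ∷ [])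
    ∷ (# 8 ∷ # 3 ∷ # 4 ∷ # 0 ∷ # 9 ∷ # 6 ∷ # 11 ∷ # 2 ∷ # 1 ∷ # 7 ∷ # 5 ∷ # 10 ∷ [])
    ∷ (# 6 ∷ # 10 ∷ # 11 ∷ # 5 ∷ # 2 ∷ # 7 ∷ # 1 ∷ # 8 ∷ # 3 ∷ # 4 ∷ # 0 ∷ # 9 ∷ [])
    ∷ [] )
  ( (# 1 ∷ # 9 ∷ # 8 ∷ # 7 ∷ # 3 ∷ # 4 ∷ # 0 ∷ # 10 ∷ # 6 ∷ # 2 ∷ # 11 ∷ # 5 ∷ [])
    ∷ (# 3 ∷ # 5 ∷ # 0 ∷ # 9 ∷ # 7 ∷ # 2 ∷ # 10 ∷ # 6 ∷ # 11 ∷ # 1 ∷ # 8 ∷ # 4 ∷ [])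
    ∷ (# 4 ∷ # 2 ∷ # 7 ∷ # 1 ∷ # 10 ∷ # 11 ∷ # 8 ∷ # 5 ∷ # 0 ∷ # 6 ∷ # 9 ∷ # 3 ∷ [])
    ∷ (# 11 ∷ # 0 ∷ # 9 ∷ # 6 ∷ # 5 ∷ # 1 ∷ # 2 ∷ # 4 ∷ # 10 ∷ # 8 ∷ # 3 ∷ # 7 ∷ [])
    ∷ (# 7 ∷ # 6 ∷ # 3 ∷ # 8 ∷ # 11 ∷ # 9 ∷ # 4 ∷ # 1 ∷ # 5 ∷ # 10 ∷ # 2 ∷ # 0 ∷ [])
    ∷ (# 5 ∷ # 8 ∷ # 10 ∷ # 2 ∷ # 6 ∷ # 3 ∷ # 9 ∷ # 0 ∷ # 4 ∷ # 11 ∷ # 7 ∷ # 1 ∷ [])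
    ∷ (# 2 ∷ # 11 ∷ # 5 ∷ # 10 ∷ # 1 ∷ # 8 ∷ # 3 ∷ # 9 ∷ # 7 ∷ # 0 ∷ # 4 ∷ # 6 ∷ [])
    ∷ (# 9 ∷ # 4 ∷ # 6 ∷ # 11 ∷ # 0 ∷ # 10 ∷ # 7 ∷ # 3 ∷ # 2 ∷ # 5 ∷ # 1 ∷ # 8 ∷ [])
    ∷ [] )
hwp*-12-4-6 4 7 refl = fromTables
  ( (# 2 ∷ # 7 ∷ # 9 ∷ # 11 ∷ # 1 ∷ # 8 ∷ # 0 ∷ # 10 ∷ # 3 ∷ # 6 ∷ # 4 ∷ # 5 ∷ [])
    ∷ (# 10 ∷ # 4 ∷ # 11 ∷ # 8 ∷ # 2 ∷ # 9 ∷ # 7 ∷ # 0 ∷ # 5 ∷ # 3 ∷ # 6 ∷ # 1 ∷ [])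
    ∷ (# 5 ∷ # 2 ∷ # 8 ∷ # 9 ∷ # 3 ∷ # 11 ∷ # 1 ∷ # 4 ∷ # 6 ∷ # 7 ∷ # 0 ∷ # 10 ∷ [])
    ∷ (# 9 ∷ # 11 ∷ # 7 ∷ # 1 ∷ # 5 ∷ # 0 ∷ # 3 ∷ # 8 ∷ # 10 ∷ # 4 ∷ # 2 ∷ # 6 ∷ [])
    ∷ [] )
  ( (# 6 ∷ # 10 ∷ # 1 ∷ # 2 ∷ # 11 ∷ # 3 ∷ # 4 ∷ # 5 ∷ # 9 ∷ # 0 ∷ # 7 ∷ # 8 ∷ [])
    ∷ (# 1 ∷ # 9 ∷ # 5 ∷ # 7 ∷ # 0 ∷ # 6 ∷ # 10 ∷ # 2 ∷ # 11 ∷ # 8 ∷ # 3 ∷ # 4 ∷ [])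
    ∷ (# 8 ∷ # 3 ∷ # 6 ∷ # 10 ∷ # 7 ∷ # 4 ∷ # 9 ∷ # 1 ∷ # 2 ∷ # 11 ∷ # 5 ∷ # 0 ∷ [])
    ∷ (# 11 ∷ # 5 ∷ # 0 ∷ # 4 ∷ # 6 ∷ # 7 ∷ # 2 ∷ # 9 ∷ # 1 ∷ # 10 ∷ # 8 ∷ # 3 ∷ [])
    ∷ (# 4 ∷ # 6 ∷ # 10 ∷ # 5 ∷ # 9 ∷ # 2 ∷ # 8 ∷ # 3 ∷ # 0 ∷ # 1 ∷ # 11 ∷ # 7 ∷ [])
    ∷ (# 3 ∷ # 0 ∷ # 4 ∷ # 6 ∷ # 8 ∷ # 10 ∷ # 5 ∷ # 11 ∷ # 7 ∷ # 2 ∷ # 1 ∷ # 9 ∷ [])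
    ∷ (# 7 ∷ # 8 ∷ # 3 ∷ # 0 ∷ # 10 ∷ # 1 ∷ # 11 ∷ # 6 ∷ # 4 ∷ # 5 ∷ # 9 ∷ # 2 ∷ [])
    ∷ [] )
hwp*-12-4-6 5 6 refl = fromTables
  ( (# 1 ∷ # 3 ∷ # 9 ∷ # 8 ∷ # 11 ∷ # 2 ∷ # 5 ∷ # 10 ∷ # 0 ∷ # 6 ∷ # 4 ∷ # 7 ∷ [])
    ∷ (# 8 ∷ # 0 ∷ # 6 ∷ # 7 ∷ # 1 ∷ # 3 ∷ # 9 ∷ # 11 ∷ # 4 ∷ # 10 ∷ # 2 ∷ # 5 ∷ [])
    ∷ (# 7 ∷ # 6 ∷ # 1 ∷ # 11 ∷ # 10 ∷ # 4 ∷ # 8 ∷ # 3 ∷ # 2 ∷ # 5 ∷ # 9 ∷ # 0 ∷ [])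
    ∷ (# 6 ∷ # 8 ∷ # 7 ∷ # 1 ∷ # 9 ∷ # 0 ∷ # 10 ∷ # 4 ∷ # 11 ∷ # 2 ∷ # 5 ∷ # 3 ∷ [])
    ∷ (# 2 ∷ # 4 ∷ # 5 ∷ # 10 ∷ # 8 ∷ # 7 ∷ # 3 ∷ # 0 ∷ # 9 ∷ # 1 ∷ # 11 ∷ # 6 ∷ [])
    ∷ [] )
  ( (# 3 ∷ # 7 ∷ # 11 ∷ # 5 ∷ # 2 ∷ # 9 ∷ # 4 ∷ # 6 ∷ # 10 ∷ # 8 ∷ # 0 ∷ # 1 ∷ [])
    ∷ (# 11 ∷ # 9 ∷ # 4 ∷ # 0 ∷ # 6 ∷ # 10 ∷ # 1 ∷ # 2 ∷ # 5 ∷ # 7 ∷ # 3 ∷ # 8 ∷ [])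
    ∷ (# 10 ∷ # 11 ∷ # 8 ∷ # 4 ∷ # 5 ∷ # 6 ∷ # 2 ∷ # 1 ∷ # 3 ∷ # 0 ∷ # 7 ∷ # 9 ∷ [])
    ∷ (# 9 ∷ # 5 ∷ # 10 ∷ # 2 ∷ # 7 ∷ # 11 ∷ # 0 ∷ # 8 ∷ # 1 ∷ # 3 ∷ # 6 ∷ # 4 ∷ [])
    ∷ (# 5 ∷ # 2 ∷ # 3 ∷ # 6 ∷ # 0 ∷ # 8 ∷ # 11 ∷ # 9 ∷ # 7 ∷ # 4 ∷ # 1 ∷ # 10 ∷ [])
    ∷ (# 4 ∷ # 10 ∷ # 0 ∷ # 9 ∷ # 3 ∷ # 1 ∷ # 7 ∷ # 5 ∷ # 6 ∷ # 11 ∷ # 8 ∷ # 2 ∷ [])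
    ∷ [] )
hwp*-12-4-6 6 5 refl = fromTables
  ( (# 6 ∷ # 2 ∷ # 0 ∷ # 4 ∷ # 10 ∷ # 7 ∷ # 1 ∷ # 8 ∷ # 9 ∷ # 5 ∷ # 11 ∷ # 3 ∷ [])
    ∷ (# 11 ∷ # 6 ∷ # 9 ∷ # 7 ∷ # 1 ∷ # 8 ∷ # 10 ∷ # 5 ∷ # 3 ∷ # 0 ∷ # 4 ∷ # 2 ∷ [])
    ∷ (# 8 ∷ # 11 ∷ # 4 ∷ # 1 ∷ # 9 ∷ # 0 ∷ # 3 ∷ # 2 ∷ # 10 ∷ # 7 ∷ # 5 ∷ # 6 ∷ [])
    ∷ (# 2 ∷ # 0 ∷ # 7 ∷ # 5 ∷ # 11 ∷ # 10 ∷ # 4 ∷ # 1 ∷ # 6 ∷ # 3 ∷ # 9 ∷ # 8 ∷ [])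
    ∷ (# 4 ∷ # 8 ∷ # 1 ∷ # 11 ∷ # 3 ∷ # 2 ∷ # 7 ∷ # 9 ∷ # 5 ∷ # 10 ∷ # 6 ∷ # 0 ∷ [])
    ∷ (# 10 ∷ # 3 ∷ # 5 ∷ # 0 ∷ # 7 ∷ # 11 ∷ # 8 ∷ # 6 ∷ # 4 ∷ # 2 ∷ # 1 ∷ # 9 ∷ [])
    ∷ [] )
  ( (# 7 ∷ # 5 ∷ # 10 ∷ # 6 ∷ # 8 ∷ # 9 ∷ # 2 ∷ # 3 ∷ # 1 ∷ # 11 ∷ # 0 ∷ # 4 ∷ [])
    ∷ (# 5 ∷ # 4 ∷ # 8 ∷ # 2 ∷ # 0 ∷ # 6 ∷ # 9 ∷ # 11 ∷ # 7 ∷ # 1 ∷ # 3 ∷ # 10 ∷ [])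
    ∷ (# 9 ∷ # 7 ∷ # 6 ∷ # 8 ∷ # 5 ∷ # 3 ∷ # 11 ∷ # 10 ∷ # 0 ∷ # 4 ∷ # 2 ∷ # 1 ∷ [])
    ∷ (# 3 ∷ # 9 ∷ # 11 ∷ # 10 ∷ # 6 ∷ # 1 ∷ # 0 ∷ # 4 ∷ # 2 ∷ # 8 ∷ # 7 ∷ # 5 ∷ [])
    ∷ (# 1 ∷ # 10 ∷ # 3 ∷ # 9 ∷ # 2 ∷ # 4 ∷ # 5 ∷ # 0 ∷ # 11 ∷ # 6 ∷ # 8 ∷ # 7 ∷ [])
    ∷ [] )
hwp*-12-4-6 7 4 refl = fromTables
  ( (# 8 ∷ # 10 ∷ # 6 ∷ # 0 ∷ # 3 ∷ # 1 ∷ # 9 ∷ # 2 ∷ # 4 ∷ # 7 ∷ # 11 ∷ # 5 ∷ [])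
    ∷ (# 3 ∷ # 7 ∷ # 11 ∷ # 10 ∷ # 1 ∷ # 0 ∷ # 8 ∷ # 9 ∷ # 2 ∷ # 4 ∷ # 5 ∷ # 6 ∷ [])
    ∷ (# 6 ∷ # 5 ∷ # 0 ∷ # 2 ∷ # 8 ∷ # 11 ∷ # 3 ∷ # 1 ∷ # 9 ∷ # 10 ∷ # 4 ∷ # 7 ∷ [])
    ∷ (# 10 ∷ # 2 ∷ # 5 ∷ # 9 ∷ # 0 ∷ # 6 ∷ # 1 ∷ # 4 ∷ # 11 ∷ # 8 ∷ # 7 ∷ # 3 ∷ [])
    ∷ (# 4 ∷ # 11 ∷ # 9 ∷ # 1 ∷ # 2 ∷ # 8 ∷ # 5 ∷ # 6 ∷ # 7 ∷ # 0 ∷ # 3 ∷ # 10 ∷ [])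
    ∷ (# 1 ∷ # 4 ∷ # 8 ∷ # 7 ∷ # 11 ∷ # 9 ∷ # 10 ∷ # 5 ∷ # 6 ∷ # 3 ∷ # 2 ∷ # 0 ∷ [])
    ∷ (# 5 ∷ # 0 ∷ # 1 ∷ # 6 ∷ # 10 ∷ # 2 ∷ # 7 ∷ # 8 ∷ # 3 ∷ # 11 ∷ # 9 ∷ # 4 ∷ [])
    ∷ [] )
  ( (# 9 ∷ # 3 ∷ # 10 ∷ # 4 ∷ # 6 ∷ # 7 ∷ # 0 ∷ # 11 ∷ # 5 ∷ # 1 ∷ # 8 ∷ # 2 ∷ [])
    ∷ (# 11 ∷ # 6 ∷ # 7 ∷ # 8 ∷ # 5 ∷ # 3 ∷ # 4 ∷ # 10 ∷ # 1 ∷ # 2 ∷ # 0 ∷ # 9 ∷ [])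
    ∷ (# 7 ∷ # 8 ∷ # 4 ∷ # 11 ∷ # 9 ∷ # 10 ∷ # 2 ∷ # 3 ∷ # 0 ∷ # 5 ∷ # 6 ∷ # 1 ∷ [])
    ∷ (# 2 ∷ # 9 ∷ # 3 ∷ # 5 ∷ # 7 ∷ # 4 ∷ # 11 ∷ # 0 ∷ # 10 ∷ # 6 ∷ # 1 ∷ # 8 ∷ [])
    ∷ [] )
hwp*-12-4-6 8 3 refl = fromTables
  ( (# 8 ∷ # 2 ∷ # 11 ∷ # 7 ∷ # 5 ∷ # 3 ∷ # 1 ∷ # 4 ∷ # 10 ∷ # 0 ∷ # 9 ∷ # 6 ∷ [])
    ∷ (# 11 ∷ # 9 ∷ # 10 ∷ # 2 ∷ # 0 ∷ # 1 ∷ # 5 ∷ # 3 ∷ # 4 ∷ # 6 ∷ # 7 ∷ # 8 ∷ [])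
    ∷ (# 1 ∷ # 4 ∷ # 6 ∷ # 10 ∷ # 7 ∷ # 8 ∷ # 3 ∷ # 0 ∷ # 9 ∷ # 11 ∷ # 2 ∷ # 5 ∷ [])
    ∷ (# 10 ∷ # 3 ∷ # 4 ∷ # 0 ∷ # 9 ∷ # 6 ∷ # 11 ∷ # 5 ∷ # 2 ∷ # 8 ∷ # 1 ∷ # 7 ∷ [])
    ∷ (# 6 ∷ # 11 ∷ # 0 ∷ # 1 ∷ # 3 ∷ # 7 ∷ # 9 ∷ # 10 ∷ # 5 ∷ # 2 ∷ # 8 ∷ # 4 ∷ [])
    ∷ (# 9 ∷ # 6 ∷ # 5 ∷ # 8 ∷ # 2 ∷ # 10 ∷ # 7 ∷ # 11 ∷ # 0 ∷ # 3 ∷ # 4 ∷ # 1 ∷ [])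
    ∷ (# 5 ∷ # 7 ∷ # 3 ∷ # 4 ∷ # 11 ∷ # 9 ∷ # 8 ∷ # 6 ∷ # 1 ∷ # 10 ∷ # 0 ∷ # 2 ∷ [])
    ∷ (# 4 ∷ # 8 ∷ # 1 ∷ # 9 ∷ # 10 ∷ # 11 ∷ # 0 ∷ # 2 ∷ # 7 ∷ # 5 ∷ # 6 ∷ # 3 ∷ [])
    ∷ [] )
  ( (# 3 ∷ # 0 ∷ # 7 ∷ # 11 ∷ # 1 ∷ # 2 ∷ # 10 ∷ # 8 ∷ # 6 ∷ # 4 ∷ # 5 ∷ # 9 ∷ [])
    ∷ (# 7 ∷ # 10 ∷ # 8 ∷ # 5 ∷ # 6 ∷ # 4 ∷ # 2 ∷ # 9 ∷ # 3 ∷ # 1 ∷ # 11 ∷ # 0 ∷ [])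
    ∷ (# 2 ∷ # 5 ∷ # 9 ∷ # 6 ∷ # 8 ∷ # 0 ∷ # 4 ∷ # 1 ∷ # 11 ∷ # 7 ∷ # 3 ∷ # 10 ∷ [])
    ∷ [] )
hwp*-12-4-6 9 2 refl = fromTables
  ( (# 5 ∷ # 0 ∷ # 11 ∷ # 4 ∷ # 10 ∷ # 7 ∷ # 2 ∷ # 1 ∷ # 6 ∷ # 3 ∷ # 9 ∷ # 8 ∷ [])
    ∷ (# 3 ∷ # 11 ∷ # 1 ∷ # 8 ∷ # 6 ∷ # 2 ∷ # 7 ∷ # 9 ∷ # 10 ∷ # 4 ∷ # 0 ∷ # 5 ∷ [])
    ∷ (# 2 ∷ # 3 ∷ # 9 ∷ # 10 ∷ # 7 ∷ # 8 ∷ # 1 ∷ # 5 ∷ # 4 ∷ # 11 ∷ # 6 ∷ # 0 ∷ [])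
    ∷ (# 4 ∷ # 8 ∷ # 3 ∷ # 5 ∷ # 1 ∷ # 9 ∷ # 10 ∷ # 11 ∷ # 0 ∷ # 2 ∷ # 7 ∷ # 6 ∷ [])
    ∷ (# 9 ∷ # 4 ∷ # 6 ∷ # 11 ∷ # 0 ∷ # 10 ∷ # 5 ∷ # 8 ∷ # 3 ∷ # 1 ∷ # 2 ∷ # 7 ∷ [])
    ∷ (# 1 ∷ # 9 ∷ # 7 ∷ # 2 ∷ # 3 ∷ # 11 ∷ # 0 ∷ # 4 ∷ # 5 ∷ # 6 ∷ # 8 ∷ # 10 ∷ [])
    ∷ (# 6 ∷ # 2 ∷ # 10 ∷ # 7 ∷ # 9 ∷ # 1 ∷ # 3 ∷ # 0 ∷ # 11 ∷ # 8 ∷ # 5 ∷ # 4 ∷ [])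
    ∷ (# 7 ∷ # 10 ∷ # 5 ∷ # 9 ∷ # 8 ∷ # 6 ∷ # 11 ∷ # 3 ∷ # 1 ∷ # 0 ∷ # 4 ∷ # 2 ∷ [])
    ∷ (# 10 ∷ # 5 ∷ # 8 ∷ # 6 ∷ # 11 ∷ # 0 ∷ # 4 ∷ # 2 ∷ # 9 ∷ # 7 ∷ # 1 ∷ # 3 ∷ [])
    ∷ [] )
  ( (# 8 ∷ # 7 ∷ # 4 ∷ # 0 ∷ # 5 ∷ # 3 ∷ # 9 ∷ # 6 ∷ # 2 ∷ # 10 ∷ # 11 ∷ # 1 ∷ [])
    ∷ (# 11 ∷ # 6 ∷ # 0 ∷ # 1 ∷ # 2 ∷ # 4 ∷ # 8 ∷ # 10 ∷ # 7 ∷ # 5 ∷ # 3 ∷ # 9 ∷ [])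
    ∷ [] )
hwp*-12-4-6 10 1 refl = fromTables
  ( (# 10 ∷ # 9 ∷ # 7 ∷ # 2 ∷ # 0 ∷ # 11 ∷ # 3 ∷ # 6 ∷ # 4 ∷ # 5 ∷ # 8 ∷ # 1 ∷ [])
    ∷ (# 9 ∷ # 10 ∷ # 11 ∷ # 8 ∷ # 3 ∷ # 1 ∷ # 4 ∷ # 5 ∷ # 6 ∷ # 2 ∷ # 7 ∷ # 0 ∷ [])
    ∷ (# 2 ∷ # 6 ∷ # 8 ∷ # 0 ∷ # 10 ∷ # 9 ∷ # 11 ∷ # 1 ∷ # 3 ∷ # 4 ∷ # 5 ∷ # 7 ∷ [])
    ∷ (# 6 ∷ # 11 ∷ # 9 ∷ # 4 ∷ # 5 ∷ # 10 ∷ # 7 ∷ # 8 ∷ # 0 ∷ # 1 ∷ # 3 ∷ # 2 ∷ [])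
    ∷ (# 3 ∷ # 7 ∷ # 10 ∷ # 6 ∷ # 1 ∷ # 0 ∷ # 5 ∷ # 11 ∷ # 2 ∷ # 8 ∷ # 9 ∷ # 4 ∷ [])
    ∷ (# 4 ∷ # 5 ∷ # 3 ∷ # 11 ∷ # 9 ∷ # 8 ∷ # 2 ∷ # 0 ∷ # 10 ∷ # 7 ∷ # 1 ∷ # 6 ∷ [])
    ∷ (# 1 ∷ # 3 ∷ # 5 ∷ # 9 ∷ # 2 ∷ # 7 ∷ # 8 ∷ # 4 ∷ # 11 ∷ # 0 ∷ # 6 ∷ # 10 ∷ [])
    ∷ (# 8 ∷ # 4 ∷ # 1 ∷ # 10 ∷ # 7 ∷ # 3 ∷ # 0 ∷ # 2 ∷ # 9 ∷ # 6 ∷ # 11 ∷ # 5 ∷ [])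
    ∷ (# 7 ∷ # 0 ∷ # 6 ∷ # 1 ∷ # 11 ∷ # 4 ∷ # 9 ∷ # 3 ∷ # 5 ∷ # 10 ∷ # 2 ∷ # 8 ∷ [])
    ∷ (# 5 ∷ # 2 ∷ # 4 ∷ # 7 ∷ # 8 ∷ # 6 ∷ # 10 ∷ # 9 ∷ # 1 ∷ # 11 ∷ # 0 ∷ # 3 ∷ [])
    ∷ [] )
  ( (# 11 ∷ # 8 ∷ # 0 ∷ # 5 ∷ # 6 ∷ # 2 ∷ # 1 ∷ # 10 ∷ # 7 ∷ # 3 ∷ # 4 ∷ # 9 ∷ [])
    ∷ [] )
hwp*-12-4-6 11 0 refl = fromTables
  ( (# 7 ∷ # 10 ∷ # 3 ∷ # 4 ∷ # 6 ∷ # 1 ∷ # 2 ∷ # 11 ∷ # 0 ∷ # 5 ∷ # 9 ∷ # 8 ∷ [])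
    ∷ (# 6 ∷ # 5 ∷ # 9 ∷ # 11 ∷ # 7 ∷ # 4 ∷ # 8 ∷ # 1 ∷ # 10 ∷ # 3 ∷ # 0 ∷ # 2 ∷ [])
    ∷ (# 9 ∷ # 0 ∷ # 11 ∷ # 2 ∷ # 10 ∷ # 3 ∷ # 1 ∷ # 8 ∷ # 4 ∷ # 6 ∷ # 7 ∷ # 5 ∷ [])
    ∷ (# 2 ∷ # 8 ∷ # 4 ∷ # 0 ∷ # 3 ∷ # 11 ∷ # 7 ∷ # 9 ∷ # 5 ∷ # 10 ∷ # 6 ∷ # 1 ∷ [])
    ∷ (# 5 ∷ # 4 ∷ # 10 ∷ # 9 ∷ # 2 ∷ # 6 ∷ # 11 ∷ # 3 ∷ # 7 ∷ # 8 ∷ # 1 ∷ # 0 ∷ [])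
    ∷ (# 10 ∷ # 11 ∷ # 8 ∷ # 7 ∷ # 1 ∷ # 9 ∷ # 4 ∷ # 2 ∷ # 3 ∷ # 0 ∷ # 5 ∷ # 6 ∷ [])
    ∷ (# 4 ∷ # 3 ∷ # 0 ∷ # 8 ∷ # 5 ∷ # 2 ∷ # 10 ∷ # 6 ∷ # 9 ∷ # 1 ∷ # 11 ∷ # 7 ∷ [])
    ∷ (# 11 ∷ # 9 ∷ # 7 ∷ # 6 ∷ # 8 ∷ # 10 ∷ # 0 ∷ # 5 ∷ # 1 ∷ # 4 ∷ # 2 ∷ # 3 ∷ [])
    ∷ (# 3 ∷ # 7 ∷ # 6 ∷ # 1 ∷ # 9 ∷ # 8 ∷ # 5 ∷ # 0 ∷ # 2 ∷ # 11 ∷ # 4 ∷ # 10 ∷ [])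
    ∷ (# 1 ∷ # 2 ∷ # 5 ∷ # 10 ∷ # 11 ∷ # 0 ∷ # 3 ∷ # 4 ∷ # 6 ∷ # 7 ∷ # 8 ∷ # 9 ∷ [])
    ∷ (# 8 ∷ # 6 ∷ # 1 ∷ # 5 ∷ # 0 ∷ # 7 ∷ # 9 ∷ # 10 ∷ # 11 ∷ # 2 ∷ # 3 ∷ # 4 ∷ [])
    ∷ [] )
  ( [] )
hwp*-12-4-6 (suc (suc (suc (suc (suc (suc (suc (suc (suc (suc (suc (suc _)))))))))))) _ ()

hwp*-12-4-12 : ∀ r s → r + s ≡ 11 → HWP* 12 4 r 12 s
hwp*-12-4-12 0 11 refl = fromTables
  ( [] )
  ( (# 1 ∷ # 5 ∷ # 10 ∷ # 9 ∷ # 11 ∷ # 2 ∷ # 8 ∷ # 4 ∷ # 7 ∷ # 6 ∷ # 3 ∷ # 0 ∷ [])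
    ∷ (# 6 ∷ # 2 ∷ # 5 ∷ # 4 ∷ # 9 ∷ # 7 ∷ # 10 ∷ # 3 ∷ # 11 ∷ # 0 ∷ # 8 ∷ # 1 ∷ [])
    ∷ (# 9 ∷ # 4 ∷ # 7 ∷ # 1 ∷ # 2 ∷ # 8 ∷ # 3 ∷ # 0 ∷ # 6 ∷ # 11 ∷ # 5 ∷ # 10 ∷ [])
    ∷ (# 4 ∷ # 11 ∷ # 1 ∷ # 0 ∷ # 6 ∷ # 3 ∷ # 9 ∷ # 8 ∷ # 10 ∷ # 7 ∷ # 2 ∷ # 5 ∷ [])
    ∷ (# 2 ∷ # 10 ∷ # 8 ∷ # 6 ∷ # 7 ∷ # 4 ∷ # 1 ∷ # 11 ∷ # 5 ∷ # 3 ∷ # 0 ∷ # 9 ∷ [])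
    ∷ (# 11 ∷ # 9 ∷ # 3 ∷ # 10 ∷ # 8 ∷ # 0 ∷ # 4 ∷ # 6 ∷ # 2 ∷ # 5 ∷ # 1 ∷ # 7 ∷ [])
    ∷ (# 3 ∷ # 7 ∷ # 0 ∷ # 8 ∷ # 10 ∷ # 1 ∷ # 5 ∷ # 9 ∷ # 4 ∷ # 2 ∷ # 11 ∷ # 6 ∷ [])
    ∷ (# 5 ∷ # 8 ∷ # 6 ∷ # 2 ∷ # 0 ∷ # 11 ∷ # 7 ∷ # 1 ∷ # 9 ∷ # 10 ∷ # 4 ∷ # 3 ∷ [])
    ∷ (# 10 ∷ # 0 ∷ # 4 ∷ # 7 ∷ # 3 ∷ # 9 ∷ # 11 ∷ # 5 ∷ # 1 ∷ # 8 ∷ # 6 ∷ # 2 ∷ [])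
    ∷ (# 7 ∷ # 3 ∷ # 11 ∷ # 5 ∷ # 1 ∷ # 6 ∷ # 2 ∷ # 10 ∷ # 0 ∷ # 4 ∷ # 9 ∷ # 8 ∷ [])
    ∷ (# 8 ∷ # 6 ∷ # 9 ∷ # 11 ∷ # 5 ∷ # 10 ∷ # 0 ∷ # 2 ∷ # 3 ∷ # 1 ∷ # 7 ∷ # 4 ∷ [])
    ∷ [] )
hwp*-12-4-12 1 10 refl = fromTables
  ( (# 11 ∷ # 7 ∷ # 10 ∷ # 9 ∷ # 3 ∷ # 6 ∷ # 1 ∷ # 5 ∷ # 4 ∷ # 8 ∷ # 0 ∷ # 2 ∷ [])
    ∷ [] )
  ( (# 10 ∷ # 0 ∷ # 6 ∷ # 2 ∷ # 5 ∷ # 3 ∷ # 11 ∷ # 9 ∷ # 7 ∷ # 4 ∷ # 8 ∷ # 1 ∷ [])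
    ∷ (# 7 ∷ # 3 ∷ # 0 ∷ # 4 ∷ # 2 ∷ # 1 ∷ # 8 ∷ # 11 ∷ # 5 ∷ # 6 ∷ # 9 ∷ # 10 ∷ [])
    ∷ (# 6 ∷ # 11 ∷ # 4 ∷ # 8 ∷ # 9 ∷ # 7 ∷ # 10 ∷ # 2 ∷ # 0 ∷ # 3 ∷ # 1 ∷ # 5 ∷ [])
    ∷ (# 2 ∷ # 9 ∷ # 1 ∷ # 5 ∷ # 11 ∷ # 0 ∷ # 4 ∷ # 10 ∷ # 3 ∷ # 7 ∷ # 6 ∷ # 8 ∷ [])
    ∷ (# 5 ∷ # 6 ∷ # 7 ∷ # 0 ∷ # 8 ∷ # 4 ∷ # 3 ∷ # 1 ∷ # 11 ∷ # 10 ∷ # 2 ∷ # 9 ∷ [])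
    ∷ (# 8 ∷ # 2 ∷ # 11 ∷ # 1 ∷ # 7 ∷ # 10 ∷ # 9 ∷ # 3 ∷ # 6 ∷ # 5 ∷ # 4 ∷ # 0 ∷ [])
    ∷ (# 3 ∷ # 5 ∷ # 8 ∷ # 11 ∷ # 10 ∷ # 9 ∷ # 2 ∷ # 6 ∷ # 1 ∷ # 0 ∷ # 7 ∷ # 4 ∷ [])
    ∷ (# 9 ∷ # 4 ∷ # 3 ∷ # 10 ∷ # 6 ∷ # 8 ∷ # 5 ∷ # 0 ∷ # 2 ∷ # 1 ∷ # 11 ∷ # 7 ∷ [])
    ∷ (# 1 ∷ # 8 ∷ # 9 ∷ # 6 ∷ # 0 ∷ # 2 ∷ # 7 ∷ # 4 ∷ # 10 ∷ # 11 ∷ # 5 ∷ # 3 ∷ [])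
    ∷ (# 4 ∷ # 10 ∷ # 5 ∷ # 7 ∷ # 1 ∷ # 11 ∷ # 0 ∷ # 8 ∷ # 9 ∷ # 2 ∷ # 3 ∷ # 6 ∷ [])
    ∷ [] )
hwp*-12-4-12 2 9 refl = fromTables
  ( (# 4 ∷ # 3 ∷ # 0 ∷ # 11 ∷ # 10 ∷ # 6 ∷ # 8 ∷ # 1 ∷ # 9 ∷ # 5 ∷ # 2 ∷ # 7 ∷ [])
    ∷ (# 2 ∷ # 6 ∷ # 1 ∷ # 8 ∷ # 9 ∷ # 3 ∷ # 0 ∷ # 10 ∷ # 11 ∷ # 7 ∷ # 4 ∷ # 5 ∷ [])
    ∷ [] )
  ( (# 10 ∷ # 7 ∷ # 11 ∷ # 5 ∷ # 0 ∷ # 1 ∷ # 3 ∷ # 8 ∷ # 2 ∷ # 4 ∷ # 6 ∷ # 9 ∷ [])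
    ∷ (# 9 ∷ # 2 ∷ # 10 ∷ # 7 ∷ # 1 ∷ # 4 ∷ # 5 ∷ # 6 ∷ # 0 ∷ # 3 ∷ # 11 ∷ # 8 ∷ [])
    ∷ (# 6 ∷ # 11 ∷ # 7 ∷ # 1 ∷ # 5 ∷ # 0 ∷ # 9 ∷ # 4 ∷ # 10 ∷ # 8 ∷ # 3 ∷ # 2 ∷ [])
    ∷ (# 5 ∷ # 4 ∷ # 6 ∷ # 2 ∷ # 8 ∷ # 9 ∷ # 11 ∷ # 0 ∷ # 3 ∷ # 1 ∷ # 7 ∷ # 10 ∷ [])
    ∷ (# 3 ∷ # 0 ∷ # 8 ∷ # 4 ∷ # 2 ∷ # 11 ∷ # 7 ∷ # 9 ∷ # 5 ∷ # 10 ∷ # 1 ∷ # 6 ∷ [])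
    ∷ (# 1 ∷ # 8 ∷ # 9 ∷ # 6 ∷ # 7 ∷ # 2 ∷ # 10 ∷ # 5 ∷ # 4 ∷ # 11 ∷ # 0 ∷ # 3 ∷ [])
    ∷ (# 7 ∷ # 9 ∷ # 5 ∷ # 0 ∷ # 3 ∷ # 10 ∷ # 4 ∷ # 11 ∷ # 6 ∷ # 2 ∷ # 8 ∷ # 1 ∷ [])
    ∷ (# 11 ∷ # 10 ∷ # 3 ∷ # 9 ∷ # 6 ∷ # 8 ∷ # 1 ∷ # 2 ∷ # 7 ∷ # 0 ∷ # 5 ∷ # 4 ∷ [])
    ∷ (# 8 ∷ # 5 ∷ # 4 ∷ # 10 ∷ # 11 ∷ # 7 ∷ # 2 ∷ # 3 ∷ # 1 ∷ # 6 ∷ # 9 ∷ # 0 ∷ [])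
    ∷ [] )
hwp*-12-4-12 3 8 refl = fromTables
  ( (# 6 ∷ # 8 ∷ # 0 ∷ # 10 ∷ # 11 ∷ # 9 ∷ # 7 ∷ # 2 ∷ # 3 ∷ # 4 ∷ # 1 ∷ # 5 ∷ [])
    ∷ (# 8 ∷ # 11 ∷ # 6 ∷ # 4 ∷ # 9 ∷ # 1 ∷ # 0 ∷ # 3 ∷ # 2 ∷ # 7 ∷ # 5 ∷ # 10 ∷ [])
    ∷ (# 1 ∷ # 5 ∷ # 3 ∷ # 7 ∷ # 0 ∷ # 4 ∷ # 8 ∷ # 11 ∷ # 9 ∷ # 10 ∷ # 6 ∷ # 2 ∷ [])
    ∷ [] )
  ( (# 5 ∷ # 6 ∷ # 9 ∷ # 0 ∷ # 10 ∷ # 7 ∷ # 2 ∷ # 4 ∷ # 11 ∷ # 3 ∷ # 8 ∷ # 1 ∷ [])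
    ∷ (# 7 ∷ # 9 ∷ # 1 ∷ # 5 ∷ # 2 ∷ # 10 ∷ # 11 ∷ # 8 ∷ # 4 ∷ # 6 ∷ # 0 ∷ # 3 ∷ [])
    ∷ (# 10 ∷ # 2 ∷ # 8 ∷ # 9 ∷ # 5 ∷ # 0 ∷ # 3 ∷ # 1 ∷ # 6 ∷ # 11 ∷ # 7 ∷ # 4 ∷ [])
    ∷ (# 3 ∷ # 0 ∷ # 11 ∷ # 8 ∷ # 1 ∷ # 2 ∷ # 4 ∷ # 10 ∷ # 7 ∷ # 5 ∷ # 9 ∷ # 6 ∷ [])
    ∷ (# 11 ∷ # 10 ∷ # 4 ∷ # 1 ∷ # 6 ∷ # 3 ∷ # 9 ∷ # 5 ∷ # 0 ∷ # 8 ∷ # 2 ∷ # 7 ∷ [])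
    ∷ (# 2 ∷ # 4 ∷ # 7 ∷ # 11 ∷ # 8 ∷ # 6 ∷ # 10 ∷ # 9 ∷ # 5 ∷ # 1 ∷ # 3 ∷ # 0 ∷ [])
    ∷ (# 4 ∷ # 3 ∷ # 5 ∷ # 2 ∷ # 7 ∷ # 8 ∷ # 1 ∷ # 6 ∷ # 10 ∷ # 0 ∷ # 11 ∷ # 9 ∷ [])
    ∷ (# 9 ∷ # 7 ∷ # 10 ∷ # 6 ∷ # 3 ∷ # 11 ∷ # 5 ∷ # 0 ∷ # 1 ∷ # 2 ∷ # 4 ∷ # 8 ∷ [])
    ∷ [] )
hwp*-12-4-12 4 7 refl = fromTables
  ( (# 11 ∷ # 7 ∷ # 10 ∷ # 2 ∷ # 1 ∷ # 4 ∷ # 9 ∷ # 5 ∷ # 3 ∷ # 0 ∷ # 8 ∷ # 6 ∷ [])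
    ∷ (# 5 ∷ # 8 ∷ # 0 ∷ # 9 ∷ # 11 ∷ # 10 ∷ # 7 ∷ # 3 ∷ # 4 ∷ # 6 ∷ # 2 ∷ # 1 ∷ [])
    ∷ (# 1 ∷ # 10 ∷ # 6 ∷ # 7 ∷ # 2 ∷ # 0 ∷ # 11 ∷ # 8 ∷ # 9 ∷ # 3 ∷ # 5 ∷ # 4 ∷ [])
    ∷ (# 6 ∷ # 0 ∷ # 4 ∷ # 11 ∷ # 7 ∷ # 3 ∷ # 10 ∷ # 9 ∷ # 5 ∷ # 2 ∷ # 1 ∷ # 8 ∷ [])
    ∷ [] )
  ( (# 10 ∷ # 5 ∷ # 11 ∷ # 6 ∷ # 3 ∷ # 2 ∷ # 8 ∷ # 1 ∷ # 7 ∷ # 4 ∷ # 9 ∷ # 0 ∷ [])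
    ∷ (# 2 ∷ # 11 ∷ # 5 ∷ # 8 ∷ # 6 ∷ # 9 ∷ # 3 ∷ # 4 ∷ # 1 ∷ # 7 ∷ # 0 ∷ # 10 ∷ [])
    ∷ (# 3 ∷ # 4 ∷ # 9 ∷ # 10 ∷ # 8 ∷ # 6 ∷ # 1 ∷ # 2 ∷ # 0 ∷ # 11 ∷ # 7 ∷ # 5 ∷ [])
    ∷ (# 9 ∷ # 3 ∷ # 8 ∷ # 4 ∷ # 5 ∷ # 7 ∷ # 0 ∷ # 10 ∷ # 6 ∷ # 1 ∷ # 11 ∷ # 2 ∷ [])
    ∷ (# 8 ∷ # 9 ∷ # 3 ∷ # 5 ∷ # 0 ∷ # 1 ∷ # 2 ∷ # 6 ∷ # 11 ∷ # 10 ∷ # 4 ∷ # 7 ∷ [])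
    ∷ (# 4 ∷ # 2 ∷ # 7 ∷ # 1 ∷ # 9 ∷ # 11 ∷ # 5 ∷ # 0 ∷ # 10 ∷ # 8 ∷ # 6 ∷ # 3 ∷ [])
    ∷ (# 7 ∷ # 6 ∷ # 1 ∷ # 0 ∷ # 10 ∷ # 8 ∷ # 4 ∷ # 11 ∷ # 2 ∷ # 5 ∷ # 3 ∷ # 9 ∷ [])
    ∷ [] )
hwp*-12-4-12 5 6 refl = fromTables
  ( (# 5 ∷ # 2 ∷ # 6 ∷ # 1 ∷ # 11 ∷ # 7 ∷ # 3 ∷ # 8 ∷ # 0 ∷ # 4 ∷ # 9 ∷ # 10 ∷ [])
    ∷ (# 8 ∷ # 11 ∷ # 4 ∷ # 6 ∷ # 9 ∷ # 1 ∷ # 0 ∷ # 5 ∷ # 3 ∷ # 10 ∷ # 2 ∷ # 7 ∷ [])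
    ∷ (# 10 ∷ # 4 ∷ # 3 ∷ # 5 ∷ # 6 ∷ # 11 ∷ # 7 ∷ # 1 ∷ # 9 ∷ # 0 ∷ # 8 ∷ # 2 ∷ [])
    ∷ (# 6 ∷ # 9 ∷ # 11 ∷ # 4 ∷ # 10 ∷ # 3 ∷ # 8 ∷ # 0 ∷ # 7 ∷ # 2 ∷ # 5 ∷ # 1 ∷ [])
    ∷ (# 7 ∷ # 0 ∷ # 1 ∷ # 8 ∷ # 5 ∷ # 9 ∷ # 4 ∷ # 2 ∷ # 10 ∷ # 6 ∷ # 11 ∷ # 3 ∷ [])
    ∷ [] )
  ( (# 3 ∷ # 6 ∷ # 10 ∷ # 9 ∷ # 0 ∷ # 8 ∷ # 11 ∷ # 4 ∷ # 2 ∷ # 1 ∷ # 7 ∷ # 5 ∷ [])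
    ∷ (# 9 ∷ # 10 ∷ # 7 ∷ # 2 ∷ # 8 ∷ # 4 ∷ # 5 ∷ # 11 ∷ # 1 ∷ # 3 ∷ # 0 ∷ # 6 ∷ [])
    ∷ (# 4 ∷ # 5 ∷ # 8 ∷ # 7 ∷ # 2 ∷ # 10 ∷ # 1 ∷ # 9 ∷ # 6 ∷ # 11 ∷ # 3 ∷ # 0 ∷ [])
    ∷ (# 2 ∷ # 8 ∷ # 5 ∷ # 0 ∷ # 1 ∷ # 6 ∷ # 10 ∷ # 3 ∷ # 11 ∷ # 7 ∷ # 4 ∷ # 9 ∷ [])
    ∷ (# 11 ∷ # 7 ∷ # 0 ∷ # 10 ∷ # 3 ∷ # 2 ∷ # 9 ∷ # 6 ∷ # 5 ∷ # 8 ∷ # 1 ∷ # 4 ∷ [])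
    ∷ (# 1 ∷ # 3 ∷ # 9 ∷ # 11 ∷ # 7 ∷ # 0 ∷ # 2 ∷ # 10 ∷ # 4 ∷ # 5 ∷ # 6 ∷ # 8 ∷ [])
    ∷ [] )
hwp*-12-4-12 6 5 refl = fromTables
  ( (# 1 ∷ # 4 ∷ # 0 ∷ # 7 ∷ # 2 ∷ # 11 ∷ # 5 ∷ # 10 ∷ # 3 ∷ # 6 ∷ # 8 ∷ # 9 ∷ [])
    ∷ (# 5 ∷ # 0 ∷ # 9 ∷ # 1 ∷ # 8 ∷ # 3 ∷ # 10 ∷ # 11 ∷ # 6 ∷ # 7 ∷ # 4 ∷ # 2 ∷ [])
    ∷ (# 2 ∷ # 7 ∷ # 11 ∷ # 4 ∷ # 1 ∷ # 0 ∷ # 8 ∷ # 3 ∷ # 9 ∷ # 10 ∷ # 6 ∷ # 5 ∷ [])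
    ∷ (# 6 ∷ # 11 ∷ # 1 ∷ # 5 ∷ # 3 ∷ # 8 ∷ # 7 ∷ # 9 ∷ # 4 ∷ # 0 ∷ # 2 ∷ # 10 ∷ [])
    ∷ (# 9 ∷ # 6 ∷ # 3 ∷ # 8 ∷ # 10 ∷ # 2 ∷ # 0 ∷ # 4 ∷ # 5 ∷ # 1 ∷ # 11 ∷ # 7 ∷ [])
    ∷ (# 10 ∷ # 8 ∷ # 4 ∷ # 2 ∷ # 6 ∷ # 1 ∷ # 3 ∷ # 5 ∷ # 7 ∷ # 11 ∷ # 9 ∷ # 0 ∷ [])
    ∷ [] )
  ( (# 11 ∷ # 3 ∷ # 7 ∷ # 0 ∷ # 9 ∷ # 6 ∷ # 4 ∷ # 1 ∷ # 10 ∷ # 2 ∷ # 5 ∷ # 8 ∷ [])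
    ∷ (# 4 ∷ # 9 ∷ # 10 ∷ # 11 ∷ # 5 ∷ # 7 ∷ # 2 ∷ # 8 ∷ # 1 ∷ # 3 ∷ # 0 ∷ # 6 ∷ [])
    ∷ (# 3 ∷ # 10 ∷ # 5 ∷ # 6 ∷ # 0 ∷ # 9 ∷ # 1 ∷ # 2 ∷ # 11 ∷ # 8 ∷ # 7 ∷ # 4 ∷ [])
    ∷ (# 8 ∷ # 5 ∷ # 6 ∷ # 9 ∷ # 7 ∷ # 10 ∷ # 11 ∷ # 0 ∷ # 2 ∷ # 4 ∷ # 3 ∷ # 1 ∷ [])
    ∷ (# 7 ∷ # 2 ∷ # 8 ∷ # 10 ∷ # 11 ∷ # 4 ∷ # 9 ∷ # 6 ∷ # 0 ∷ # 5 ∷ # 1 ∷ # 3 ∷ [])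
    ∷ [] )
hwp*-12-4-12 7 4 refl = fromTables
  ( (# 5 ∷ # 10 ∷ # 6 ∷ # 9 ∷ # 7 ∷ # 1 ∷ # 4 ∷ # 2 ∷ # 3 ∷ # 11 ∷ # 0 ∷ # 8 ∷ [])
    ∷ (# 4 ∷ # 6 ∷ # 8 ∷ # 10 ∷ # 2 ∷ # 11 ∷ # 5 ∷ # 9 ∷ # 0 ∷ # 3 ∷ # 7 ∷ # 1 ∷ [])
    ∷ (# 2 ∷ # 5 ∷ # 3 ∷ # 11 ∷ # 8 ∷ # 9 ∷ # 7 ∷ # 4 ∷ # 6 ∷ # 10 ∷ # 1 ∷ # 0 ∷ [])
    ∷ (# 8 ∷ # 11 ∷ # 4 ∷ # 6 ∷ # 3 ∷ # 0 ∷ # 2 ∷ # 1 ∷ # 10 ∷ # 7 ∷ # 5 ∷ # 9 ∷ [])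
    ∷ (# 10 ∷ # 3 ∷ # 9 ∷ # 7 ∷ # 6 ∷ # 4 ∷ # 11 ∷ # 8 ∷ # 1 ∷ # 0 ∷ # 2 ∷ # 5 ∷ [])
    ∷ (# 11 ∷ # 4 ∷ # 10 ∷ # 0 ∷ # 5 ∷ # 6 ∷ # 1 ∷ # 3 ∷ # 9 ∷ # 2 ∷ # 8 ∷ # 7 ∷ [])
    ∷ (# 1 ∷ # 2 ∷ # 7 ∷ # 5 ∷ # 9 ∷ # 10 ∷ # 8 ∷ # 0 ∷ # 4 ∷ # 6 ∷ # 11 ∷ # 3 ∷ [])
    ∷ [] )
  ( (# 3 ∷ # 9 ∷ # 1 ∷ # 8 ∷ # 10 ∷ # 7 ∷ # 0 ∷ # 11 ∷ # 2 ∷ # 5 ∷ # 6 ∷ # 4 ∷ [])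
    ∷ (# 7 ∷ # 8 ∷ # 11 ∷ # 4 ∷ # 0 ∷ # 2 ∷ # 3 ∷ # 10 ∷ # 5 ∷ # 1 ∷ # 9 ∷ # 6 ∷ [])
    ∷ (# 6 ∷ # 7 ∷ # 0 ∷ # 2 ∷ # 1 ∷ # 3 ∷ # 9 ∷ # 5 ∷ # 11 ∷ # 8 ∷ # 4 ∷ # 10 ∷ [])
    ∷ (# 9 ∷ # 0 ∷ # 5 ∷ # 1 ∷ # 11 ∷ # 8 ∷ # 10 ∷ # 6 ∷ # 7 ∷ # 4 ∷ # 3 ∷ # 2 ∷ [])
    ∷ [] )
hwp*-12-4-12 8 3 refl = fromTables
  ( (# 7 ∷ # 6 ∷ # 4 ∷ # 8 ∷ # 3 ∷ # 10 ∷ # 0 ∷ # 1 ∷ # 2 ∷ # 11 ∷ # 9 ∷ # 5 ∷ [])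
    ∷ (# 5 ∷ # 0 ∷ # 6 ∷ # 11 ∷ # 2 ∷ # 8 ∷ # 10 ∷ # 9 ∷ # 1 ∷ # 3 ∷ # 4 ∷ # 7 ∷ [])
    ∷ (# 2 ∷ # 3 ∷ # 1 ∷ # 0 ∷ # 7 ∷ # 9 ∷ # 5 ∷ # 10 ∷ # 6 ∷ # 8 ∷ # 11 ∷ # 4 ∷ [])
    ∷ (# 6 ∷ # 9 ∷ # 11 ∷ # 5 ∷ # 10 ∷ # 4 ∷ # 1 ∷ # 2 ∷ # 7 ∷ # 0 ∷ # 3 ∷ # 8 ∷ [])
    ∷ (# 8 ∷ # 10 ∷ # 7 ∷ # 1 ∷ # 5 ∷ # 0 ∷ # 3 ∷ # 11 ∷ # 4 ∷ # 2 ∷ # 6 ∷ # 9 ∷ [])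
    ∷ (# 11 ∷ # 4 ∷ # 0 ∷ # 6 ∷ # 8 ∷ # 3 ∷ # 7 ∷ # 5 ∷ # 9 ∷ # 1 ∷ # 2 ∷ # 10 ∷ [])
    ∷ (# 9 ∷ # 5 ∷ # 10 ∷ # 2 ∷ # 0 ∷ # 6 ∷ # 11 ∷ # 4 ∷ # 3 ∷ # 7 ∷ # 8 ∷ # 1 ∷ [])
    ∷ (# 10 ∷ # 11 ∷ # 3 ∷ # 9 ∷ # 1 ∷ # 2 ∷ # 4 ∷ # 8 ∷ # 0 ∷ # 5 ∷ # 7 ∷ # 6 ∷ [])
    ∷ [] )
  ( (# 3 ∷ # 2 ∷ # 9 ∷ # 7 ∷ # 11 ∷ # 1 ∷ # 8 ∷ # 6 ∷ # 10 ∷ # 4 ∷ # 5 ∷ # 0 ∷ [])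
    ∷ (# 4 ∷ # 7 ∷ # 8 ∷ # 10 ∷ # 9 ∷ # 11 ∷ # 2 ∷ # 0 ∷ # 5 ∷ # 6 ∷ # 1 ∷ # 3 ∷ [])
    ∷ (# 1 ∷ # 8 ∷ # 5 ∷ # 4 ∷ # 6 ∷ # 7 ∷ # 9 ∷ # 3 ∷ # 11 ∷ # 10 ∷ # 0 ∷ # 2 ∷ [])
    ∷ [] )
hwp*-12-4-12 9 2 refl = fromTables
  ( (# 2 ∷ # 0 ∷ # 8 ∷ # 9 ∷ # 7 ∷ # 4 ∷ # 10 ∷ # 11 ∷ # 1 ∷ # 6 ∷ # 3 ∷ # 5 ∷ [])
    ∷ (# 7 ∷ # 4 ∷ # 6 ∷ # 2 ∷ # 8 ∷ # 0 ∷ # 11 ∷ # 10 ∷ # 9 ∷ # 1 ∷ # 5 ∷ # 3 ∷ [])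
    ∷ (# 9 ∷ # 10 ∷ # 5 ∷ # 11 ∷ # 0 ∷ # 1 ∷ # 8 ∷ # 4 ∷ # 3 ∷ # 7 ∷ # 2 ∷ # 6 ∷ [])
    ∷ (# 6 ∷ # 5 ∷ # 3 ∷ # 0 ∷ # 1 ∷ # 11 ∷ # 2 ∷ # 9 ∷ # 10 ∷ # 8 ∷ # 7 ∷ # 4 ∷ [])
    ∷ (# 5 ∷ # 9 ∷ # 7 ∷ # 6 ∷ # 10 ∷ # 3 ∷ # 0 ∷ # 1 ∷ # 4 ∷ # 2 ∷ # 11 ∷ # 8 ∷ [])
    ∷ (# 3 ∷ # 7 ∷ # 10 ∷ # 4 ∷ # 9 ∷ # 2 ∷ # 5 ∷ # 8 ∷ # 11 ∷ # 0 ∷ # 6 ∷ # 1 ∷ [])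
    ∷ (# 10 ∷ # 3 ∷ # 11 ∷ # 5 ∷ # 2 ∷ # 6 ∷ # 1 ∷ # 0 ∷ # 7 ∷ # 4 ∷ # 8 ∷ # 9 ∷ [])
    ∷ (# 1 ∷ # 11 ∷ # 9 ∷ # 7 ∷ # 3 ∷ # 8 ∷ # 4 ∷ # 6 ∷ # 2 ∷ # 5 ∷ # 0 ∷ # 10 ∷ [])
    ∷ (# 11 ∷ # 8 ∷ # 0 ∷ # 1 ∷ # 5 ∷ # 9 ∷ # 3 ∷ # 2 ∷ # 6 ∷ # 10 ∷ # 4 ∷ # 7 ∷ [])
    ∷ [] )
  ( (# 8 ∷ # 2 ∷ # 4 ∷ # 10 ∷ # 6 ∷ # 7 ∷ # 9 ∷ # 3 ∷ # 5 ∷ # 11 ∷ # 1 ∷ # 0 ∷ [])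
    ∷ (# 4 ∷ # 6 ∷ # 1 ∷ # 8 ∷ # 11 ∷ # 10 ∷ # 7 ∷ # 5 ∷ # 0 ∷ # 3 ∷ # 9 ∷ # 2 ∷ [])
    ∷ [] )
hwp*-12-4-12 10 1 refl = fromTables
  ( (# 2 ∷ # 10 ∷ # 3 ∷ # 6 ∷ # 1 ∷ # 11 ∷ # 0 ∷ # 8 ∷ # 5 ∷ # 4 ∷ # 9 ∷ # 7 ∷ [])
    ∷ (# 4 ∷ # 0 ∷ # 11 ∷ # 5 ∷ # 8 ∷ # 7 ∷ # 3 ∷ # 6 ∷ # 1 ∷ # 10 ∷ # 2 ∷ # 9 ∷ [])
    ∷ (# 11 ∷ # 3 ∷ # 8 ∷ # 10 ∷ # 9 ∷ # 6 ∷ # 4 ∷ # 1 ∷ # 0 ∷ # 5 ∷ # 7 ∷ # 2 ∷ [])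
    ∷ (# 6 ∷ # 11 ∷ # 10 ∷ # 7 ∷ # 0 ∷ # 4 ∷ # 5 ∷ # 2 ∷ # 9 ∷ # 1 ∷ # 3 ∷ # 8 ∷ [])
    ∷ (# 10 ∷ # 4 ∷ # 6 ∷ # 0 ∷ # 11 ∷ # 1 ∷ # 7 ∷ # 9 ∷ # 3 ∷ # 2 ∷ # 8 ∷ # 5 ∷ [])
    ∷ (# 3 ∷ # 5 ∷ # 9 ∷ # 1 ∷ # 2 ∷ # 0 ∷ # 8 ∷ # 4 ∷ # 11 ∷ # 7 ∷ # 6 ∷ # 10 ∷ [])
    ∷ (# 8 ∷ # 7 ∷ # 1 ∷ # 2 ∷ # 5 ∷ # 9 ∷ # 10 ∷ # 3 ∷ # 6 ∷ # 11 ∷ # 0 ∷ # 4 ∷ [])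
    ∷ (# 7 ∷ # 9 ∷ # 0 ∷ # 8 ∷ # 3 ∷ # 2 ∷ # 11 ∷ # 5 ∷ # 10 ∷ # 6 ∷ # 4 ∷ # 1 ∷ [])
    ∷ (# 5 ∷ # 8 ∷ # 7 ∷ # 9 ∷ # 10 ∷ # 3 ∷ # 2 ∷ # 11 ∷ # 4 ∷ # 0 ∷ # 1 ∷ # 6 ∷ [])
    ∷ (# 9 ∷ # 2 ∷ # 4 ∷ # 11 ∷ # 6 ∷ # 8 ∷ # 1 ∷ # 10 ∷ # 7 ∷ # 3 ∷ # 5 ∷ # 0 ∷ [])
    ∷ [] )
  ( (# 1 ∷ # 6 ∷ # 5 ∷ # 4 ∷ # 7 ∷ # 10 ∷ # 9 ∷ # 0 ∷ # 2 ∷ # 8 ∷ # 11 ∷ # 3 ∷ [])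
    ∷ [] )
hwp*-12-4-12 11 0 refl = fromTables
  ( (# 8 ∷ # 10 ∷ # 9 ∷ # 7 ∷ # 11 ∷ # 6 ∷ # 2 ∷ # 4 ∷ # 1 ∷ # 5 ∷ # 0 ∷ # 3 ∷ [])
    ∷ (# 11 ∷ # 2 ∷ # 0 ∷ # 5 ∷ # 3 ∷ # 10 ∷ # 8 ∷ # 6 ∷ # 9 ∷ # 7 ∷ # 4 ∷ # 1 ∷ [])
    ∷ (# 5 ∷ # 7 ∷ # 1 ∷ # 2 ∷ # 9 ∷ # 4 ∷ # 11 ∷ # 3 ∷ # 6 ∷ # 0 ∷ # 8 ∷ # 10 ∷ [])
    ∷ (# 9 ∷ # 4 ∷ # 11 ∷ # 1 ∷ # 10 ∷ # 0 ∷ # 7 ∷ # 2 ∷ # 5 ∷ # 8 ∷ # 3 ∷ # 6 ∷ [])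
    ∷ (# 4 ∷ # 0 ∷ # 10 ∷ # 8 ∷ # 7 ∷ # 2 ∷ # 5 ∷ # 1 ∷ # 11 ∷ # 3 ∷ # 6 ∷ # 9 ∷ [])
    ∷ (# 7 ∷ # 6 ∷ # 3 ∷ # 11 ∷ # 2 ∷ # 8 ∷ # 9 ∷ # 5 ∷ # 0 ∷ # 10 ∷ # 1 ∷ # 4 ∷ [])
    ∷ (# 10 ∷ # 8 ∷ # 5 ∷ # 4 ∷ # 1 ∷ # 7 ∷ # 0 ∷ # 11 ∷ # 3 ∷ # 6 ∷ # 9 ∷ # 2 ∷ [])
    ∷ (# 1 ∷ # 5 ∷ # 7 ∷ # 9 ∷ # 6 ∷ # 11 ∷ # 3 ∷ # 8 ∷ # 10 ∷ # 4 ∷ # 2 ∷ # 0 ∷ [])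
    ∷ (# 6 ∷ # 3 ∷ # 4 ∷ # 0 ∷ # 5 ∷ # 9 ∷ # 1 ∷ # 10 ∷ # 7 ∷ # 2 ∷ # 11 ∷ # 8 ∷ [])
    ∷ (# 3 ∷ # 9 ∷ # 6 ∷ # 10 ∷ # 8 ∷ # 1 ∷ # 4 ∷ # 0 ∷ # 2 ∷ # 11 ∷ # 7 ∷ # 5 ∷ [])
    ∷ (# 2 ∷ # 11 ∷ # 8 ∷ # 6 ∷ # 0 ∷ # 3 ∷ # 10 ∷ # 9 ∷ # 4 ∷ # 1 ∷ # 5 ∷ # 7 ∷ [])
    ∷ [] )
  ( [] )
hwp*-12-4-12 (suc (suc (suc (suc (suc (suc (suc (suc (suc (suc (suc (suc _)))))))))))) _ ()

hwp*-12-6-12 : ∀ r s → r + s ≡ 11 → HWP* 12 6 r 12 s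
hwp*-12-6-12 0 11 refl = fromTables
  ( [] )
  ( (# 2 ∷ # 8 ∷ # 5 ∷ # 1 ∷ # 3 ∷ # 6 ∷ # 4 ∷ # 10 ∷ # 9 ∷ # 7 ∷ # 11 ∷ # 0 ∷ [])
    ∷ (# 10 ∷ # 3 ∷ # 9 ∷ # 6 ∷ # 2 ∷ # 4 ∷ # 5 ∷ # 0 ∷ # 11 ∷ # 8 ∷ # 1 ∷ # 7 ∷ [])
    ∷ (# 8 ∷ # 2 ∷ # 4 ∷ # 11 ∷ # 9 ∷ # 10 ∷ # 1 ∷ # 3 ∷ # 5 ∷ # 0 ∷ # 7 ∷ # 6 ∷ [])
    ∷ (# 3 ∷ # 11 ∷ # 0 ∷ # 10 ∷ # 5 ∷ # 9 ∷ # 7 ∷ # 8 ∷ # 1 ∷ # 2 ∷ # 6 ∷ # 4 ∷ [])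
    ∷ (# 5 ∷ # 4 ∷ # 1 ∷ # 8 ∷ # 0 ∷ # 7 ∷ # 11 ∷ # 9 ∷ # 6 ∷ # 3 ∷ # 2 ∷ # 10 ∷ [])
    ∷ (# 9 ∷ # 6 ∷ # 7 ∷ # 5 ∷ # 8 ∷ # 11 ∷ # 2 ∷ # 4 ∷ # 0 ∷ # 10 ∷ # 3 ∷ # 1 ∷ [])
    ∷ (# 4 ∷ # 5 ∷ # 10 ∷ # 7 ∷ # 6 ∷ # 0 ∷ # 8 ∷ # 1 ∷ # 2 ∷ # 11 ∷ # 9 ∷ # 3 ∷ [])
    ∷ (# 7 ∷ # 10 ∷ # 6 ∷ # 9 ∷ # 11 ∷ # 3 ∷ # 0 ∷ # 5 ∷ # 4 ∷ # 1 ∷ # 8 ∷ # 2 ∷ [])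
    ∷ (# 11 ∷ # 9 ∷ # 3 ∷ # 4 ∷ # 1 ∷ # 8 ∷ # 10 ∷ # 2 ∷ # 7 ∷ # 6 ∷ # 0 ∷ # 5 ∷ [])
    ∷ (# 1 ∷ # 7 ∷ # 11 ∷ # 0 ∷ # 10 ∷ # 2 ∷ # 9 ∷ # 6 ∷ # 3 ∷ # 4 ∷ # 5 ∷ # 8 ∷ [])
    ∷ (# 6 ∷ # 0 ∷ # 8 ∷ # 2 ∷ # 7 ∷ # 1 ∷ # 3 ∷ # 11 ∷ # 10 ∷ # 5 ∷ # 4 ∷ # 9 ∷ [])
    ∷ [] )
hwp*-12-6-12 1 10 refl = fromTables
  ( (# 5 ∷ # 9 ∷ # 6 ∷ # 8 ∷ # 2 ∷ # 10 ∷ # 3 ∷ # 4 ∷ # 7 ∷ # 0 ∷ # 11 ∷ # 1 ∷ [])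
    ∷ [] )
  ( (# 8 ∷ # 11 ∷ # 10 ∷ # 6 ∷ # 5 ∷ # 1 ∷ # 4 ∷ # 2 ∷ # 9 ∷ # 3 ∷ # 0 ∷ # 7 ∷ [])
    ∷ (# 6 ∷ # 5 ∷ # 11 ∷ # 1 ∷ # 10 ∷ # 4 ∷ # 9 ∷ # 8 ∷ # 0 ∷ # 2 ∷ # 7 ∷ # 3 ∷ [])
    ∷ (# 1 ∷ # 3 ∷ # 9 ∷ # 5 ∷ # 8 ∷ # 6 ∷ # 10 ∷ # 11 ∷ # 2 ∷ # 7 ∷ # 4 ∷ # 0 ∷ [])
    ∷ (# 2 ∷ # 10 ∷ # 8 ∷ # 11 ∷ # 7 ∷ # 9 ∷ # 5 ∷ # 0 ∷ # 6 ∷ # 1 ∷ # 3 ∷ # 4 ∷ [])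
    ∷ (# 3 ∷ # 8 ∷ # 7 ∷ # 4 ∷ # 1 ∷ # 2 ∷ # 0 ∷ # 9 ∷ # 5 ∷ # 11 ∷ # 6 ∷ # 10 ∷ [])
    ∷ (# 10 ∷ # 0 ∷ # 4 ∷ # 7 ∷ # 3 ∷ # 11 ∷ # 2 ∷ # 5 ∷ # 1 ∷ # 6 ∷ # 9 ∷ # 8 ∷ [])
    ∷ (# 4 ∷ # 7 ∷ # 0 ∷ # 2 ∷ # 9 ∷ # 3 ∷ # 1 ∷ # 10 ∷ # 11 ∷ # 8 ∷ # 5 ∷ # 6 ∷ [])
    ∷ (# 9 ∷ # 4 ∷ # 5 ∷ # 0 ∷ # 11 ∷ # 7 ∷ # 8 ∷ # 6 ∷ # 3 ∷ # 10 ∷ # 1 ∷ # 2 ∷ [])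
    ∷ (# 11 ∷ # 6 ∷ # 1 ∷ # 9 ∷ # 0 ∷ # 8 ∷ # 7 ∷ # 3 ∷ # 10 ∷ # 4 ∷ # 2 ∷ # 5 ∷ [])
    ∷ (# 7 ∷ # 2 ∷ # 3 ∷ # 10 ∷ # 6 ∷ # 0 ∷ # 11 ∷ # 1 ∷ # 4 ∷ # 5 ∷ # 8 ∷ # 9 ∷ [])
    ∷ [] )
hwp*-12-6-12 2 9 refl = fromTables
  ( (# 1 ∷ # 2 ∷ # 4 ∷ # 11 ∷ # 6 ∷ # 10 ∷ # 7 ∷ # 0 ∷ # 3 ∷ # 5 ∷ # 8 ∷ # 9 ∷ [])
    ∷ (# 3 ∷ # 8 ∷ # 5 ∷ # 4 ∷ # 1 ∷ # 7 ∷ # 2 ∷ # 10 ∷ # 9 ∷ # 0 ∷ # 11 ∷ # 6 ∷ [])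
    ∷ [] )
  ( (# 10 ∷ # 9 ∷ # 7 ∷ # 0 ∷ # 3 ∷ # 2 ∷ # 11 ∷ # 4 ∷ # 6 ∷ # 8 ∷ # 1 ∷ # 5 ∷ [])
    ∷ (# 8 ∷ # 4 ∷ # 3 ∷ # 7 ∷ # 5 ∷ # 6 ∷ # 0 ∷ # 1 ∷ # 11 ∷ # 2 ∷ # 9 ∷ # 10 ∷ [])
    ∷ (# 4 ∷ # 7 ∷ # 0 ∷ # 9 ∷ # 10 ∷ # 3 ∷ # 1 ∷ # 11 ∷ # 2 ∷ # 6 ∷ # 5 ∷ # 8 ∷ [])
    ∷ (# 7 ∷ # 6 ∷ # 1 ∷ # 10 ∷ # 8 ∷ # 11 ∷ # 9 ∷ # 2 ∷ # 5 ∷ # 4 ∷ # 0 ∷ # 3 ∷ [])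
    ∷ (# 11 ∷ # 0 ∷ # 8 ∷ # 2 ∷ # 7 ∷ # 1 ∷ # 5 ∷ # 9 ∷ # 10 ∷ # 3 ∷ # 6 ∷ # 4 ∷ [])
    ∷ (# 2 ∷ # 3 ∷ # 11 ∷ # 6 ∷ # 9 ∷ # 0 ∷ # 8 ∷ # 5 ∷ # 4 ∷ # 10 ∷ # 7 ∷ # 1 ∷ [])
    ∷ (# 5 ∷ # 11 ∷ # 10 ∷ # 8 ∷ # 0 ∷ # 9 ∷ # 4 ∷ # 6 ∷ # 7 ∷ # 1 ∷ # 3 ∷ # 2 ∷ [])
    ∷ (# 9 ∷ # 10 ∷ # 6 ∷ # 5 ∷ # 11 ∷ # 4 ∷ # 3 ∷ # 8 ∷ # 1 ∷ # 7 ∷ # 2 ∷ # 0 ∷ [])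
    ∷ (# 6 ∷ # 5 ∷ # 9 ∷ # 1 ∷ # 2 ∷ # 8 ∷ # 10 ∷ # 3 ∷ # 0 ∷ # 11 ∷ # 4 ∷ # 7 ∷ [])
    ∷ [] )
hwp*-12-6-12 3 8 refl = fromTables
  ( (# 5 ∷ # 6 ∷ # 10 ∷ # 7 ∷ # 1 ∷ # 9 ∷ # 0 ∷ # 8 ∷ # 11 ∷ # 4 ∷ # 3 ∷ # 2 ∷ [])
    ∷ (# 9 ∷ # 3 ∷ # 7 ∷ # 8 ∷ # 2 ∷ # 6 ∷ # 11 ∷ # 1 ∷ # 4 ∷ # 10 ∷ # 5 ∷ # 0 ∷ [])
    ∷ (# 10 ∷ # 7 ∷ # 6 ∷ # 4 ∷ # 5 ∷ # 2 ∷ # 9 ∷ # 11 ∷ # 0 ∷ # 3 ∷ # 1 ∷ # 8 ∷ [])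
    ∷ [] )
  ( (# 8 ∷ # 2 ∷ # 9 ∷ # 11 ∷ # 0 ∷ # 7 ∷ # 1 ∷ # 4 ∷ # 3 ∷ # 5 ∷ # 6 ∷ # 10 ∷ [])
    ∷ (# 1 ∷ # 8 ∷ # 3 ∷ # 9 ∷ # 11 ∷ # 0 ∷ # 7 ∷ # 10 ∷ # 2 ∷ # 6 ∷ # 4 ∷ # 5 ∷ [])
    ∷ (# 6 ∷ # 4 ∷ # 8 ∷ # 0 ∷ # 3 ∷ # 11 ∷ # 5 ∷ # 2 ∷ # 10 ∷ # 1 ∷ # 9 ∷ # 7 ∷ [])
    ∷ (# 2 ∷ # 11 ∷ # 5 ∷ # 1 ∷ # 10 ∷ # 8 ∷ # 4 ∷ # 3 ∷ # 6 ∷ # 0 ∷ # 7 ∷ # 9 ∷ [])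
    ∷ (# 11 ∷ # 0 ∷ # 1 ∷ # 10 ∷ # 6 ∷ # 4 ∷ # 2 ∷ # 5 ∷ # 9 ∷ # 7 ∷ # 8 ∷ # 3 ∷ [])
    ∷ (# 7 ∷ # 10 ∷ # 11 ∷ # 2 ∷ # 9 ∷ # 1 ∷ # 3 ∷ # 6 ∷ # 5 ∷ # 8 ∷ # 0 ∷ # 4 ∷ [])
    ∷ (# 3 ∷ # 9 ∷ # 4 ∷ # 5 ∷ # 7 ∷ # 10 ∷ # 8 ∷ # 0 ∷ # 1 ∷ # 2 ∷ # 11 ∷ # 6 ∷ [])
    ∷ (# 4 ∷ # 5 ∷ # 0 ∷ # 6 ∷ # 8 ∷ # 3 ∷ # 10 ∷ # 9 ∷ # 7 ∷ # 11 ∷ # 2 ∷ # 1 ∷ [])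
    ∷ [] )
hwp*-12-6-12 4 7 refl = fromTables
  ( (# 11 ∷ # 10 ∷ # 1 ∷ # 7 ∷ # 8 ∷ # 0 ∷ # 5 ∷ # 6 ∷ # 2 ∷ # 4 ∷ # 9 ∷ # 3 ∷ [])
    ∷ (# 2 ∷ # 8 ∷ # 3 ∷ # 10 ∷ # 6 ∷ # 11 ∷ # 0 ∷ # 1 ∷ # 5 ∷ # 7 ∷ # 4 ∷ # 9 ∷ [])
    ∷ (# 9 ∷ # 7 ∷ # 0 ∷ # 11 ∷ # 10 ∷ # 4 ∷ # 2 ∷ # 5 ∷ # 1 ∷ # 3 ∷ # 8 ∷ # 6 ∷ [])
    ∷ (# 7 ∷ # 9 ∷ # 10 ∷ # 4 ∷ # 0 ∷ # 6 ∷ # 1 ∷ # 2 ∷ # 11 ∷ # 8 ∷ # 3 ∷ # 5 ∷ [])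
    ∷ [] )
  ( (# 3 ∷ # 2 ∷ # 9 ∷ # 1 ∷ # 5 ∷ # 10 ∷ # 11 ∷ # 0 ∷ # 4 ∷ # 6 ∷ # 7 ∷ # 8 ∷ [])
    ∷ (# 5 ∷ # 4 ∷ # 7 ∷ # 8 ∷ # 3 ∷ # 2 ∷ # 9 ∷ # 11 ∷ # 10 ∷ # 0 ∷ # 6 ∷ # 1 ∷ [])
    ∷ (# 10 ∷ # 5 ∷ # 6 ∷ # 0 ∷ # 1 ∷ # 8 ∷ # 7 ∷ # 9 ∷ # 3 ∷ # 11 ∷ # 2 ∷ # 4 ∷ [])
    ∷ (# 4 ∷ # 0 ∷ # 8 ∷ # 5 ∷ # 2 ∷ # 9 ∷ # 10 ∷ # 3 ∷ # 6 ∷ # 1 ∷ # 11 ∷ # 7 ∷ [])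
    ∷ (# 6 ∷ # 11 ∷ # 4 ∷ # 9 ∷ # 7 ∷ # 1 ∷ # 3 ∷ # 8 ∷ # 0 ∷ # 10 ∷ # 5 ∷ # 2 ∷ [])
    ∷ (# 1 ∷ # 3 ∷ # 5 ∷ # 6 ∷ # 11 ∷ # 7 ∷ # 8 ∷ # 4 ∷ # 9 ∷ # 2 ∷ # 0 ∷ # 10 ∷ [])
    ∷ (# 8 ∷ # 6 ∷ # 11 ∷ # 2 ∷ # 9 ∷ # 3 ∷ # 4 ∷ # 10 ∷ # 7 ∷ # 5 ∷ # 1 ∷ # 0 ∷ [])
    ∷ [] )
hwp*-12-6-12 5 6 refl = fromTables
  ( (# 8 ∷ # 5 ∷ # 11 ∷ # 2 ∷ # 10 ∷ # 9 ∷ # 4 ∷ # 1 ∷ # 7 ∷ # 0 ∷ # 3 ∷ # 6 ∷ [])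
    ∷ (# 9 ∷ # 6 ∷ # 5 ∷ # 0 ∷ # 11 ∷ # 4 ∷ # 2 ∷ # 10 ∷ # 3 ∷ # 7 ∷ # 8 ∷ # 1 ∷ [])
    ∷ (# 10 ∷ # 11 ∷ # 7 ∷ # 5 ∷ # 1 ∷ # 0 ∷ # 3 ∷ # 8 ∷ # 4 ∷ # 6 ∷ # 9 ∷ # 2 ∷ [])
    ∷ (# 3 ∷ # 4 ∷ # 1 ∷ # 7 ∷ # 5 ∷ # 11 ∷ # 9 ∷ # 6 ∷ # 2 ∷ # 10 ∷ # 0 ∷ # 8 ∷ [])
    ∷ (# 5 ∷ # 0 ∷ # 10 ∷ # 1 ∷ # 2 ∷ # 7 ∷ # 8 ∷ # 11 ∷ # 9 ∷ # 4 ∷ # 6 ∷ # 3 ∷ [])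
    ∷ [] )
  ( (# 11 ∷ # 8 ∷ # 9 ∷ # 10 ∷ # 6 ∷ # 2 ∷ # 5 ∷ # 4 ∷ # 0 ∷ # 3 ∷ # 1 ∷ # 7 ∷ [])
    ∷ (# 1 ∷ # 3 ∷ # 0 ∷ # 8 ∷ # 9 ∷ # 6 ∷ # 11 ∷ # 5 ∷ # 10 ∷ # 2 ∷ # 7 ∷ # 4 ∷ [])
    ∷ (# 4 ∷ # 10 ∷ # 6 ∷ # 9 ∷ # 3 ∷ # 1 ∷ # 7 ∷ # 0 ∷ # 11 ∷ # 8 ∷ # 2 ∷ # 5 ∷ [])
    ∷ (# 7 ∷ # 2 ∷ # 3 ∷ # 4 ∷ # 0 ∷ # 8 ∷ # 1 ∷ # 9 ∷ # 6 ∷ # 11 ∷ # 5 ∷ # 10 ∷ [])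
    ∷ (# 2 ∷ # 7 ∷ # 4 ∷ # 6 ∷ # 8 ∷ # 10 ∷ # 0 ∷ # 3 ∷ # 5 ∷ # 1 ∷ # 11 ∷ # 9 ∷ [])
    ∷ (# 6 ∷ # 9 ∷ # 8 ∷ # 11 ∷ # 7 ∷ # 3 ∷ # 10 ∷ # 2 ∷ # 1 ∷ # 5 ∷ # 4 ∷ # 0 ∷ [])
    ∷ [] )
hwp*-12-6-12 6 5 refl = fromTables
  ( (# 3 ∷ # 6 ∷ # 10 ∷ # 1 ∷ # 2 ∷ # 9 ∷ # 8 ∷ # 0 ∷ # 7 ∷ # 11 ∷ # 5 ∷ # 4 ∷ [])
    ∷ (# 10 ∷ # 0 ∷ # 1 ∷ # 7 ∷ # 9 ∷ # 2 ∷ # 3 ∷ # 8 ∷ # 4 ∷ # 6 ∷ # 11 ∷ # 5 ∷ [])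
    ∷ (# 8 ∷ # 9 ∷ # 5 ∷ # 11 ∷ # 0 ∷ # 10 ∷ # 1 ∷ # 3 ∷ # 2 ∷ # 7 ∷ # 4 ∷ # 6 ∷ [])
    ∷ (# 5 ∷ # 8 ∷ # 6 ∷ # 4 ∷ # 1 ∷ # 3 ∷ # 11 ∷ # 10 ∷ # 0 ∷ # 2 ∷ # 9 ∷ # 7 ∷ [])
    ∷ (# 9 ∷ # 2 ∷ # 11 ∷ # 8 ∷ # 3 ∷ # 7 ∷ # 4 ∷ # 6 ∷ # 5 ∷ # 10 ∷ # 1 ∷ # 0 ∷ [])
    ∷ (# 2 ∷ # 11 ∷ # 8 ∷ # 6 ∷ # 5 ∷ # 0 ∷ # 7 ∷ # 1 ∷ # 9 ∷ # 4 ∷ # 3 ∷ # 10 ∷ [])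
    ∷ [] )
  ( (# 6 ∷ # 3 ∷ # 0 ∷ # 2 ∷ # 11 ∷ # 8 ∷ # 10 ∷ # 4 ∷ # 1 ∷ # 5 ∷ # 7 ∷ # 9 ∷ [])
    ∷ (# 4 ∷ # 10 ∷ # 9 ∷ # 5 ∷ # 7 ∷ # 1 ∷ # 2 ∷ # 11 ∷ # 3 ∷ # 0 ∷ # 6 ∷ # 8 ∷ [])
    ∷ (# 1 ∷ # 4 ∷ # 7 ∷ # 10 ∷ # 8 ∷ # 11 ∷ # 5 ∷ # 9 ∷ # 6 ∷ # 3 ∷ # 0 ∷ # 2 ∷ [])
    ∷ (# 11 ∷ # 7 ∷ # 3 ∷ # 0 ∷ # 6 ∷ # 4 ∷ # 9 ∷ # 5 ∷ # 10 ∷ # 8 ∷ # 2 ∷ # 1 ∷ [])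
    ∷ (# 7 ∷ # 5 ∷ # 4 ∷ # 9 ∷ # 10 ∷ # 6 ∷ # 0 ∷ # 2 ∷ # 11 ∷ # 1 ∷ # 8 ∷ # 3 ∷ [])
    ∷ [] )
hwp*-12-6-12 7 4 refl = fromTables
  ( (# 3 ∷ # 11 ∷ # 9 ∷ # 1 ∷ # 0 ∷ # 4 ∷ # 2 ∷ # 6 ∷ # 10 ∷ # 8 ∷ # 7 ∷ # 5 ∷ [])
    ∷ (# 2 ∷ # 8 ∷ # 1 ∷ # 10 ∷ # 7 ∷ # 6 ∷ # 4 ∷ # 11 ∷ # 3 ∷ # 5 ∷ # 0 ∷ # 9 ∷ [])
    ∷ (# 7 ∷ # 3 ∷ # 6 ∷ # 9 ∷ # 8 ∷ # 0 ∷ # 10 ∷ # 2 ∷ # 1 ∷ # 11 ∷ # 5 ∷ # 4 ∷ [])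
    ∷ (# 5 ∷ # 0 ∷ # 4 ∷ # 6 ∷ # 3 ∷ # 10 ∷ # 7 ∷ # 9 ∷ # 11 ∷ # 2 ∷ # 8 ∷ # 1 ∷ [])
    ∷ (# 10 ∷ # 6 ∷ # 3 ∷ # 4 ∷ # 11 ∷ # 2 ∷ # 0 ∷ # 1 ∷ # 5 ∷ # 7 ∷ # 9 ∷ # 8 ∷ [])
    ∷ (# 8 ∷ # 7 ∷ # 0 ∷ # 11 ∷ # 10 ∷ # 9 ∷ # 3 ∷ # 5 ∷ # 6 ∷ # 4 ∷ # 1 ∷ # 2 ∷ [])
    ∷ (# 6 ∷ # 2 ∷ # 5 ∷ # 8 ∷ # 1 ∷ # 7 ∷ # 11 ∷ # 10 ∷ # 9 ∷ # 0 ∷ # 4 ∷ # 3 ∷ [])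
    ∷ [] )
  ( (# 4 ∷ # 10 ∷ # 8 ∷ # 5 ∷ # 9 ∷ # 11 ∷ # 1 ∷ # 3 ∷ # 7 ∷ # 6 ∷ # 2 ∷ # 0 ∷ [])
    ∷ (# 11 ∷ # 9 ∷ # 7 ∷ # 2 ∷ # 5 ∷ # 1 ∷ # 8 ∷ # 0 ∷ # 4 ∷ # 10 ∷ # 3 ∷ # 6 ∷ [])
    ∷ (# 1 ∷ # 5 ∷ # 10 ∷ # 0 ∷ # 6 ∷ # 8 ∷ # 9 ∷ # 4 ∷ # 2 ∷ # 3 ∷ # 11 ∷ # 7 ∷ [])
    ∷ (# 9 ∷ # 4 ∷ # 11 ∷ # 7 ∷ # 2 ∷ # 3 ∷ # 5 ∷ # 8 ∷ # 0 ∷ # 1 ∷ # 6 ∷ # 10 ∷ [])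
    ∷ [] )
hwp*-12-6-12 8 3 refl = fromTables
  ( (# 8 ∷ # 7 ∷ # 11 ∷ # 0 ∷ # 10 ∷ # 3 ∷ # 4 ∷ # 6 ∷ # 2 ∷ # 1 ∷ # 9 ∷ # 5 ∷ [])
    ∷ (# 11 ∷ # 5 ∷ # 7 ∷ # 4 ∷ # 1 ∷ # 2 ∷ # 8 ∷ # 3 ∷ # 9 ∷ # 0 ∷ # 6 ∷ # 10 ∷ [])
    ∷ (# 5 ∷ # 3 ∷ # 10 ∷ # 8 ∷ # 9 ∷ # 6 ∷ # 1 ∷ # 11 ∷ # 0 ∷ # 2 ∷ # 7 ∷ # 4 ∷ [])
    ∷ (# 7 ∷ # 6 ∷ # 8 ∷ # 1 ∷ # 3 ∷ # 0 ∷ # 11 ∷ # 10 ∷ # 5 ∷ # 4 ∷ # 2 ∷ # 9 ∷ [])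
    ∷ (# 6 ∷ # 0 ∷ # 1 ∷ # 9 ∷ # 2 ∷ # 8 ∷ # 7 ∷ # 4 ∷ # 11 ∷ # 10 ∷ # 5 ∷ # 3 ∷ [])
    ∷ (# 1 ∷ # 9 ∷ # 5 ∷ # 7 ∷ # 11 ∷ # 10 ∷ # 3 ∷ # 0 ∷ # 4 ∷ # 6 ∷ # 8 ∷ # 2 ∷ [])
    ∷ (# 9 ∷ # 8 ∷ # 4 ∷ # 6 ∷ # 0 ∷ # 7 ∷ # 10 ∷ # 2 ∷ # 3 ∷ # 5 ∷ # 11 ∷ # 1 ∷ [])
    ∷ (# 4 ∷ # 10 ∷ # 3 ∷ # 5 ∷ # 8 ∷ # 9 ∷ # 2 ∷ # 1 ∷ # 7 ∷ # 11 ∷ # 0 ∷ # 6 ∷ [])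
    ∷ [] )
  ( (# 3 ∷ # 2 ∷ # 0 ∷ # 11 ∷ # 6 ∷ # 1 ∷ # 9 ∷ # 5 ∷ # 10 ∷ # 7 ∷ # 4 ∷ # 8 ∷ [])
    ∷ (# 2 ∷ # 4 ∷ # 9 ∷ # 10 ∷ # 5 ∷ # 11 ∷ # 0 ∷ # 8 ∷ # 6 ∷ # 3 ∷ # 1 ∷ # 7 ∷ [])
    ∷ (# 10 ∷ # 11 ∷ # 6 ∷ # 2 ∷ # 7 ∷ # 4 ∷ # 5 ∷ # 9 ∷ # 1 ∷ # 8 ∷ # 3 ∷ # 0 ∷ [])
    ∷ [] )
hwp*-12-6-12 9 2 refl = fromTables
  ( (# 2 ∷ # 5 ∷ # 8 ∷ # 6 ∷ # 3 ∷ # 10 ∷ # 9 ∷ # 11 ∷ # 1 ∷ # 7 ∷ # 0 ∷ # 4 ∷ [])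
    ∷ (# 6 ∷ # 9 ∷ # 5 ∷ # 2 ∷ # 11 ∷ # 7 ∷ # 8 ∷ # 4 ∷ # 10 ∷ # 0 ∷ # 1 ∷ # 3 ∷ [])
    ∷ (# 10 ∷ # 3 ∷ # 9 ∷ # 4 ∷ # 8 ∷ # 0 ∷ # 11 ∷ # 2 ∷ # 6 ∷ # 5 ∷ # 7 ∷ # 1 ∷ [])
    ∷ (# 1 ∷ # 10 ∷ # 11 ∷ # 9 ∷ # 0 ∷ # 6 ∷ # 2 ∷ # 5 ∷ # 7 ∷ # 4 ∷ # 3 ∷ # 8 ∷ [])
    ∷ (# 11 ∷ # 7 ∷ # 3 ∷ # 8 ∷ # 5 ∷ # 9 ∷ # 4 ∷ # 6 ∷ # 0 ∷ # 1 ∷ # 2 ∷ # 10 ∷ [])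
    ∷ (# 8 ∷ # 2 ∷ # 7 ∷ # 1 ∷ # 6 ∷ # 11 ∷ # 5 ∷ # 10 ∷ # 4 ∷ # 3 ∷ # 9 ∷ # 0 ∷ [])
    ∷ (# 4 ∷ # 11 ∷ # 10 ∷ # 0 ∷ # 2 ∷ # 1 ∷ # 3 ∷ # 9 ∷ # 5 ∷ # 8 ∷ # 6 ∷ # 7 ∷ [])
    ∷ (# 5 ∷ # 6 ∷ # 4 ∷ # 7 ∷ # 10 ∷ # 3 ∷ # 0 ∷ # 1 ∷ # 9 ∷ # 11 ∷ # 8 ∷ # 2 ∷ [])
    ∷ (# 7 ∷ # 4 ∷ # 0 ∷ # 5 ∷ # 9 ∷ # 2 ∷ # 1 ∷ # 8 ∷ # 3 ∷ # 10 ∷ # 11 ∷ # 6 ∷ [])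
    ∷ [] )
  ( (# 9 ∷ # 0 ∷ # 1 ∷ # 11 ∷ # 7 ∷ # 8 ∷ # 10 ∷ # 3 ∷ # 2 ∷ # 6 ∷ # 4 ∷ # 5 ∷ [])
    ∷ (# 3 ∷ # 8 ∷ # 6 ∷ # 10 ∷ # 1 ∷ # 4 ∷ # 7 ∷ # 0 ∷ # 11 ∷ # 2 ∷ # 5 ∷ # 9 ∷ [])
    ∷ [] )
hwp*-12-6-12 10 1 refl = fromTables
  ( (# 6 ∷ # 7 ∷ # 1 ∷ # 10 ∷ # 11 ∷ # 9 ∷ # 4 ∷ # 3 ∷ # 2 ∷ # 0 ∷ # 8 ∷ # 5 ∷ [])
    ∷ (# 8 ∷ # 11 ∷ # 9 ∷ # 4 ∷ # 7 ∷ # 2 ∷ # 10 ∷ # 5 ∷ # 6 ∷ # 3 ∷ # 1 ∷ # 0 ∷ [])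
    ∷ (# 7 ∷ # 6 ∷ # 11 ∷ # 1 ∷ # 0 ∷ # 10 ∷ # 8 ∷ # 9 ∷ # 5 ∷ # 2 ∷ # 3 ∷ # 4 ∷ [])
    ∷ (# 10 ∷ # 0 ∷ # 3 ∷ # 8 ∷ # 6 ∷ # 7 ∷ # 11 ∷ # 2 ∷ # 9 ∷ # 5 ∷ # 4 ∷ # 1 ∷ [])
    ∷ (# 4 ∷ # 5 ∷ # 0 ∷ # 9 ∷ # 8 ∷ # 3 ∷ # 2 ∷ # 1 ∷ # 10 ∷ # 11 ∷ # 6 ∷ # 7 ∷ [])
    ∷ (# 3 ∷ # 10 ∷ # 8 ∷ # 2 ∷ # 5 ∷ # 6 ∷ # 7 ∷ # 11 ∷ # 1 ∷ # 4 ∷ # 0 ∷ # 9 ∷ [])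
    ∷ (# 1 ∷ # 3 ∷ # 4 ∷ # 7 ∷ # 9 ∷ # 0 ∷ # 5 ∷ # 6 ∷ # 11 ∷ # 8 ∷ # 2 ∷ # 10 ∷ [])
    ∷ (# 2 ∷ # 9 ∷ # 5 ∷ # 6 ∷ # 1 ∷ # 11 ∷ # 0 ∷ # 8 ∷ # 4 ∷ # 10 ∷ # 7 ∷ # 3 ∷ [])
    ∷ (# 5 ∷ # 2 ∷ # 10 ∷ # 0 ∷ # 3 ∷ # 8 ∷ # 9 ∷ # 4 ∷ # 7 ∷ # 1 ∷ # 11 ∷ # 6 ∷ [])
    ∷ (# 9 ∷ # 4 ∷ # 7 ∷ # 11 ∷ # 2 ∷ # 1 ∷ # 3 ∷ # 10 ∷ # 0 ∷ # 6 ∷ # 5 ∷ # 8 ∷ [])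
    ∷ [] )
  ( (# 11 ∷ # 8 ∷ # 6 ∷ # 5 ∷ # 10 ∷ # 4 ∷ # 1 ∷ # 0 ∷ # 3 ∷ # 7 ∷ # 9 ∷ # 2 ∷ [])
    ∷ [] )
hwp*-12-6-12 11 0 refl = fromTables
  ( (# 2 ∷ # 7 ∷ # 8 ∷ # 11 ∷ # 3 ∷ # 4 ∷ # 1 ∷ # 0 ∷ # 6 ∷ # 10 ∷ # 5 ∷ # 9 ∷ [])
    ∷ (# 5 ∷ # 6 ∷ # 7 ∷ # 9 ∷ # 11 ∷ # 2 ∷ # 10 ∷ # 4 ∷ # 3 ∷ # 1 ∷ # 8 ∷ # 0 ∷ [])
    ∷ (# 9 ∷ # 2 ∷ # 4 ∷ # 0 ∷ # 7 ∷ # 11 ∷ # 3 ∷ # 5 ∷ # 10 ∷ # 8 ∷ # 6 ∷ # 1 ∷ [])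
    ∷ (# 11 ∷ # 3 ∷ # 5 ∷ # 10 ∷ # 6 ∷ # 8 ∷ # 0 ∷ # 9 ∷ # 1 ∷ # 4 ∷ # 2 ∷ # 7 ∷ [])
    ∷ (# 4 ∷ # 9 ∷ # 3 ∷ # 6 ∷ # 8 ∷ # 1 ∷ # 11 ∷ # 2 ∷ # 5 ∷ # 0 ∷ # 7 ∷ # 10 ∷ [])
    ∷ (# 1 ∷ # 5 ∷ # 0 ∷ # 4 ∷ # 2 ∷ # 3 ∷ # 8 ∷ # 10 ∷ # 7 ∷ # 11 ∷ # 9 ∷ # 6 ∷ [])
    ∷ (# 7 ∷ # 8 ∷ # 11 ∷ # 2 ∷ # 10 ∷ # 6 ∷ # 9 ∷ # 1 ∷ # 4 ∷ # 3 ∷ # 0 ∷ # 5 ∷ [])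
    ∷ (# 10 ∷ # 4 ∷ # 1 ∷ # 7 ∷ # 5 ∷ # 9 ∷ # 2 ∷ # 8 ∷ # 0 ∷ # 6 ∷ # 11 ∷ # 3 ∷ [])
    ∷ (# 6 ∷ # 0 ∷ # 9 ∷ # 8 ∷ # 1 ∷ # 10 ∷ # 7 ∷ # 11 ∷ # 2 ∷ # 5 ∷ # 3 ∷ # 4 ∷ [])
    ∷ (# 8 ∷ # 10 ∷ # 6 ∷ # 1 ∷ # 9 ∷ # 0 ∷ # 5 ∷ # 3 ∷ # 11 ∷ # 7 ∷ # 4 ∷ # 2 ∷ [])
    ∷ (# 3 ∷ # 11 ∷ # 10 ∷ # 5 ∷ # 0 ∷ # 7 ∷ # 4 ∷ # 6 ∷ # 9 ∷ # 2 ∷ # 1 ∷ # 8 ∷ [])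
    ∷ [] )
  ( [] )
hwp*-12-6-12 (suc (suc (suc (suc (suc (suc (suc (suc (suc (suc (suc (suc _)))))))))))) _ ()

lemma3p6 : (m n : ℕ) →
    ((m ≡ 4 × n ≡ 6) ⊎ (m ≡ 4 × n ≡ 12) ⊎ (m ≡ 6 × n ≡ 12)) →
    (r s : ℕ) → HWP* 12 m r n s ⇔ (r + s ≡ 11)
lemma3p6 .4 .6  (inj₁ (refl , refl))        r s = mk⇔ HWP*⇒r+s≡v (hwp*-12-4-6 r s)
lemma3p6 .4 .12 (inj₂ (inj₁ (refl , refl))) r s = mk⇔ HWP*⇒r+s≡v (hwp*-12-4-12 r s)
lemma3p6 .6 .12 (inj₂ (inj₂ (refl , refl))) r s = mk⇔ HWP*⇒r+s≡v (hwp*-12-6-12 r s)
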